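{- Let $F$ be a forest such that $\overline F$ is spherical, let $A=(a_1,\ldots,a_r)$ be a maximal resolution of $\overline F$, and suppose that $a_i$ dominates $b_i$ in $(\overline F:a_1\cdots a_{i-1})$ for each $i\in[r]$. Then there is an order of the variables such that $a_1<b_1<a_2<b_2<\cdots<a_r<b_r$ are the first $2r$ variables; with such an order, the reduced homology of $R(\overline F)$ is generated by the cycle $z:=\prod_{i=1}^r(a_i-b_i)$ (terms containing a square being zero).
   Context: For $F$ on vertex set $X=\{x_1,\dots,x_n\}$, the edge ideal $\overline F\subset\mathbb{Z}[X]$ is generated by $x_1^2,\ldots,x_n^2$ and $x_ix_j$ for edges $\{x_i,x_j\}$; $R(\overline F)$ is the independence complex (monomials not in $\overline F$). Simplicial chains of $R(I)$ are identified with $\mathbb{Z}[X]/I$, chains of dimension $i-1$ being spanned by the face monomials of degree $i$, with the boundary map determined by a total order on the variables. For a monomial ideal $I$ containing all $x_i^2$: $(I:x)=\{m:xm\in I\}$; $R(I)$ is a cone with apex $a$ if $(I:a)=(I,a)$; $a$ dominates $b$ in $I$ if $R(I)$ is not a cone with apex $b$ but $R((I,a))$ is. A sequence $(a_1,\ldots,a_r)$ of variables with $I_i=(I:a_1\cdots a_{i-1})$ is a resolution if for all $i\in[r]$, $a_i\notin I_i$ and either $R(I_i)$ is a cone with apex $a_i$ or $a_i$ dominates some variable in $I_i$; it is maximal if not extendable, and spherical if no $R(I_i)$ ($i\in[r]$) is a cone with apex $a_i$. $I$ is spherical if it admits a spherical maximal resolution. -}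

module Defs where

open import Data.Bool using (Bool; true; false; _∧_; _∨_; not; if_then_else_)
open import Data.Nat using (ℕ; zero; suc; _+_; _*_; _<_; _<ᵇ_; _≡ᵇ_)
open import Data.Integer as ℤ using (ℤ; 0ℤ; 1ℤ; -_)
open import Data.Fin using (Fin; zero; suc; toℕ; inject₁; fromℕ)
open import Data.Fin.Subset using (Subset; ⁅_⁆; _∪_; ∣_∣) renaming (⊥ to ∅)
open import Data.Fin.Permutation using (Permutation′; _⟨$⟩ʳ_)
open import Data.Vec using (Vec; []; _∷_; lookup)
open import Data.List as List using (List; []; _∷_; _∷ʳ_; length; take; allFin; filter; foldr; tabulate)
open import Data.Product using (Σ; ∃; _×_; _,_)
open import Data.Sum using (_⊎_)
open import Data.Empty using (⊥)
open import Function.Definitions using (Injective)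
open import Relation.Nullary using (¬_)
open import Relation.Binary.PropositionalEquality using (_≡_)

record SimpleGraph (n : ℕ) : Set where
  field
    adj    : Fin n → Fin n → Bool
    sym    : ∀ u v → adj u v ≡ adj v u
    irrefl : ∀ v → adj v v ≡ false
open SimpleGraph public

record Cycle {n : ℕ} (G : SimpleGraph n) : Set where
  field
    m       : ℕ
    long    : 2 Data.Nat.≤ m
    f       : Fin (suc m) → Fin n
    f-inj   : Injective _≡_ _≡_ f
    steps   : ∀ (i : Fin m) → adj G (f (inject₁ i)) (f (suc i)) ≡ true
    closing : adj G (f (fromℕ m)) (f zero) ≡ true

Forest : ∀ {n} → SimpleGraph n → Set
Forest G = ¬ Cycle G

-- Monomial ideals of ℤ[x_0,…,x_{n-1}] containing all squares x_i^2.
-- Such an ideal is determined by which squarefree monomials it contains;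
-- squarefree monomials are identified with subsets of the variables.
-- (I σ ≡ true) means the squarefree monomial ∏_{i∈σ} x_i lies in I.
-- The faces of R(I) are exactly the σ with I σ ≡ false.

SqIdeal : ℕ → Set
SqIdeal n = Subset n → Bool

_≐_ : ∀ {n} → SqIdeal n → SqIdeal n → Set
I ≐ J = ∀ σ → I σ ≡ J σ

_∈I_ : ∀ {n} → Fin n → SqIdeal n → Set
x ∈I I = I ⁅ x ⁆ ≡ true

-- edge ideal \overline{G}: generated by all x_i^2 and x_i x_j for edges;
-- a squarefree monomial lies in it iff it contains both ends of some edge
anyFin : ∀ {n} → (Fin n → Bool) → Bool
anyFin p = foldr (λ v b → p v ∨ b) false (allFin _)

edgeIdeal : ∀ {n} → SimpleGraph n → SqIdeal n
edgeIdeal G σ = anyFin λ u → anyFin λ v → lookup σ u ∧ lookup σ v ∧ adj G u v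

-- colon ideal (I : x): a squarefree m lies in it iff x·m ∈ I
-- (x·m has a square if x ∈ m)
colon : ∀ {n} → SqIdeal n → Fin n → SqIdeal n
colon I x σ = lookup σ x ∨ I (σ ∪ ⁅ x ⁆)

colonProd : ∀ {n} → SqIdeal n → List (Fin n) → SqIdeal n
colonProd I []       = I
colonProd I (a ∷ as) = colonProd (colon I a) as

addVar : ∀ {n} → SqIdeal n → Fin n → SqIdeal n
addVar I a σ = I σ ∨ lookup σ a

-- R(I) is a cone with apex a
IsCone : ∀ {n} → SqIdeal n → Fin n → Set
IsCone I a = colon I a ≐ addVar I a

Dominates : ∀ {n} → SqIdeal n → Fin n → Fin n → Set
Dominates I a b = ¬ IsCone I b × IsCone (addVar I a) b

-- a sequence A = (a_1,…,a_r) (indices 0,…,r-1 here); I_i = (I : a_1 ⋯ a_{i-1})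
stage : ∀ {n} → SqIdeal n → (A : List (Fin n)) → Fin (length A) → SqIdeal n
stage I A i = colonProd I (take (toℕ i) A)

IsResolution : ∀ {n} → SqIdeal n → List (Fin n) → Set
IsResolution {n} I A = ∀ (i : Fin (length A)) →
  ¬ (List.lookup A i ∈I stage I A i)
  × (IsCone (stage I A i) (List.lookup A i)
     ⊎ ∃ λ (b : Fin n) → Dominates (stage I A i) (List.lookup A i) b)

IsMaximalResolution : ∀ {n} → SqIdeal n → List (Fin n) → Set
IsMaximalResolution {n} I A =
  IsResolution I A × ¬ (∃ λ (a : Fin n) → IsResolution I (A ∷ʳ a))

IsSphericalResolution : ∀ {n} → SqIdeal n → List (Fin n) → Set
IsSphericalResolution I A =
  IsResolution I A × (∀ (i : Fin (length A)) → ¬ IsCone (stage I A i) (List.lookup A i))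

IsSpherical : ∀ {n} → SqIdeal n → Set
IsSpherical {n} I = ∃ λ (A : List (Fin n)) →
  IsMaximalResolution I A × IsSphericalResolution I A

-- Simplicial chains of R(I), identified with ℤ[X]/I: a chain assigns an
-- integer coefficient to every squarefree monomial, vanishing on those in I.
-- The total order on the variables is given by a permutation π (u < v iff
-- π u < π v), and π u is the position of u.

Chain : ℕ → Set
Chain n = Subset n → ℤ

Supported : ∀ {n} → SqIdeal n → Chain n → Set
Supported I c = ∀ σ → I σ ≡ true → c σ ≡ 0ℤ

rank : ∀ {n} → Permutation′ n → Fin n → ℕ
rank π v = toℕ (π ⟨$⟩ʳ v)

negPow : ℕ → ℤ
negPow zero    = 1ℤ
negPow (suc k) = - negPow k

sumFin : ∀ {n} → (Fin n → ℤ) → ℤ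
sumFin f = foldr (λ v s → f v ℤ.+ s) 0ℤ (allFin _)

below : ∀ {n} → Permutation′ n → Subset n → Fin n → ℕ
below π σ v = length (filter (λ u → Data.Bool.T? (lookup σ u ∧ (rank π u <ᵇ rank π v))) (allFin _))
  where import Data.Bool

-- simplicial boundary (augmented, so reduced homology):
-- ∂ [v_0 < … < v_k] = Σ_j (-1)^j [v_0 … v̂_j … v_k];
-- the coefficient of σ in ∂c is Σ_{v ∉ σ} (-1)^{#{u∈σ : u<v}} c(σ ∪ {v})
boundary : ∀ {n} → SqIdeal n → Permutation′ n → Chain n → Chain n
boundary I π c σ =
  if I σ then 0ℤ
  else sumFin (λ v → if lookup σ v then 0ℤ
                     else negPow (below π σ v) ℤ.* c (σ ∪ ⁅ v ⁆))

-- the reduced homology of R(I) (all degrees together) is generated by the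
-- class of z: z is a cycle, and every cycle is an integer multiple of z
-- plus a boundary
HomologyGeneratedBy : ∀ {n} → SqIdeal n → Permutation′ n → Chain n → Set
HomologyGeneratedBy {n} I π z =
  Supported I z × (∀ σ → boundary I π z σ ≡ 0ℤ) ×
  (∀ (c : Chain n) → Supported I c → (∀ σ → boundary I π c σ ≡ 0ℤ) →
     ∃ λ (k : ℤ) → ∃ λ (d : Chain n) → Supported I d ×
       (∀ σ → c σ ≡ k ℤ.* z σ ℤ.+ boundary I π d σ))

-- The element z = ∏_{i} (a_i - b_i) of ℤ[X]/I, expanded: a choice
-- s ∈ {0,1}^r picks a_i (s_i = false) or b_i (s_i = true) and contributes
-- (-1)^{#b's} times the monomial of the chosen variables; the monomial is
-- zero if it contains a square (chosen variables not distinct) or lies in I.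

allChoices : (r : ℕ) → List (Vec Bool r)
allChoices zero    = [] ∷ []
allChoices (suc r) = List.concatMap (λ s → (false ∷ s) ∷ (true ∷ s) ∷ []) (allChoices r)

eqSub : ∀ {n} → Subset n → Subset n → Bool
eqSub []       []       = true
eqSub (x ∷ xs) (y ∷ ys) = (if x then y else not y) ∧ eqSub xs ys

listSet : ∀ {n} → List (Fin n) → Subset n
listSet = foldr (λ v s → ⁅ v ⁆ ∪ s) ∅

countTrue : ∀ {r} → Vec Bool r → ℕ
countTrue []          = 0
countTrue (true ∷ s)  = suc (countTrue s)
countTrue (false ∷ s) = countTrue s

productCycle : ∀ {n r} → SqIdeal n → (Fin r → Fin n) → (Fin r → Fin n) → Chain n
productCycle {n} {r} I a b σ =
  foldr (λ s acc → term s ℤ.+ acc) 0ℤ (allChoices r)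
  where
    chosen : Vec Bool r → List (Fin n)
    chosen s = tabulate (λ i → if lookup s i then b i else a i)
    term : Vec Bool r → ℤ
    term s = if eqSub σ (listSet (chosen s))
                ∧ (∣ listSet (chosen s) ∣ ≡ᵇ r)
                ∧ not (I σ)
             then negPow (countTrue s) else 0ℤ

-- Order the variables so that a₁ < b₁ < ⋯ < aᵣ < bᵣ come first and let Iᵢ = (F̄ : a₁ ⋯ aᵢ₋₁).
-- Since aᵢ dominates bᵢ, the face aᵢbᵢ lies in Iᵢ and, away from aᵢ, R(Iᵢ) is a cone with apex bᵢ.
-- If a variable x precedes every vertex in the support of a chain f, the Leibniz rule
-- ∂(x·f) = f − x·∂f holds.  Writing a cycle c of R(Iᵢ) as c = w + aᵢ·u + bᵢ·v with w, u, v
-- supported on faces avoiding aᵢ and bᵢ, the cycle condition makes u a cycle of R(Iᵢ₊₁) and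
-- gives c = ∂(bᵢ·w) + (aᵢ − bᵢ)·u.  Hence if z′ generates the homology of R(Iᵢ₊₁), then
-- (aᵢ − bᵢ)·z′ generates that of R(Iᵢ).  The induction starts from the last ideal, which contains
-- every variable: otherwise the forest left after deleting its variables has an isolated vertex
-- (a cone apex) or a leaf (dominated by its neighbour), and the resolution would extend.  There
-- R is the empty simplex, whose homology is generated by ∅.  The 2r variables are distinct
-- because aᵢ, bᵢ ∈ Iᵢ₊₁ while aⱼ, bⱼ ∉ Iⱼ for j > i.

module Submission where

open import Algebra.Bundles using (CommutativeMonoid)
open import Data.Bool using (Bool; true; false; _∧_; _∨_; not; if_then_else_)
open import Data.Bool.Properties
  using ( ¬-not; T-≡; ∧-zeroʳ; ∧-identityʳ; ∧-conicalˡ; ∧-conicalʳ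
        ; ∨-zeroʳ; ∨-identityʳ; ∨-conicalˡ; ∨-conicalʳ )
import Data.Bool.Properties as Bool
open import Data.Empty using (⊥; ⊥-elim)
open import Data.Fin using (Fin; zero; suc; toℕ; inject₁; inject≤; fromℕ; fromℕ<; lower₁)
open import Data.Fin.Permutation using (Permutation′; _⟨$⟩ʳ_; _⟨$⟩ˡ_; inverseˡ)
import Data.Fin.Permutation as Perm
import Data.Fin.Permutation.Components as PC
open import Data.Fin.Properties
  using ( _≟_; any?; suc-injective; toℕ-injective; toℕ-inject₁; toℕ-inject≤; toℕ-fromℕ; toℕ-fromℕ<; toℕ<n
        ; inject≤-injective; inject₁-injective; injective⇒≤; fromℕ≢inject₁; inject₁-lower₁ )
open import Data.Fin.Subset using (Subset; ⁅_⁆; _∪_; _-_; ∣_∣) renaming (⊥ to ∅)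
open import Data.Fin.Subset.Properties using (p─⊥≡p; ∪-identityˡ; ∣⊥∣≡0)
open import Data.Integer using (ℤ; 0ℤ; 1ℤ; -_)
import Data.Integer as ℤ
import Data.Integer.Properties as ℤ
open import Data.Integer.Solver using (module +-*-Solver)
open import Data.List as List using (List; []; _∷_; _∷ʳ_; length; lookup; foldr; allFin)
open import Data.Nat using (ℕ; _*_; _+_)
import Data.Nat as ℕ
import Data.Nat.Properties as ℕ
open import Data.Product using (∃; ∃₂; _×_; _,_; proj₁; proj₂)
open import Data.Sum using (_⊎_; inj₁; inj₂; [_,_]′)
open import Data.Vec as Vec using (Vec; []; _∷_)
import Data.Vec.Properties as Vec
open import Function using (_∘_; case_of_)
open import Function.Bundles using (Equivalence)
open import Function.Definitions using (Injective)
open import Relation.Binary using (tri<; tri≈; tri>)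
open import Relation.Binary.PropositionalEquality
  using (_≡_; _≢_; refl; sym; trans; cong; cong₂; subst; _≗_; module ≡-Reasoning)
open import Relation.Nullary using (¬_; Dec; yes; no; ¬?)
open import Relation.Nullary.Decidable using (_×-dec_; dec-true; dec-false)

open import Defs hiding (sym)

open +-*-Solver using (solve; _:+_; _:-_; :-_; _:*_; _:=_; con)
open import Algebra.Properties.CommutativeSemigroup ℤ.+-commutativeSemigroup
  using () renaming (interchange to +-interchange)
open import Algebra.Properties.CommutativeSemigroup
  (CommutativeMonoid.commutativeSemigroup Bool.∧-commutativeMonoid)
  using () renaming (x∙yz≈y∙xz to ∧-left-comm)

private variable n : ℕ

absurdᵇ : {A : Set} {b : Bool} → b ≡ true → b ≡ false → A
absurdᵇ refl ()

lookup-ext : (σ τ : Subset n) → Vec.lookup σ ≗ Vec.lookup τ → σ ≡ τ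
lookup-ext σ τ eq =
  trans (sym (Vec.tabulate∘lookup σ)) (trans (Vec.tabulate-cong eq) (Vec.tabulate∘lookup τ))

lookup-∪ : (p q : Subset n) (x : Fin n) → Vec.lookup (p ∪ q) x ≡ (Vec.lookup p x ∨ Vec.lookup q x)
lookup-∪ p q x = Vec.lookup-zipWith _∨_ x p q

lookup-∅ : (x : Fin n) → Vec.lookup (∅ {n}) x ≡ false
lookup-∅ x = Vec.lookup-replicate x false

lookup-⁅x⁆ : (x : Fin n) → Vec.lookup ⁅ x ⁆ x ≡ true
lookup-⁅x⁆ zero    = refl
lookup-⁅x⁆ (suc x) = lookup-⁅x⁆ x

lookup-⁅y⁆ : (x y : Fin n) → x ≢ y → Vec.lookup ⁅ y ⁆ x ≡ false
lookup-⁅y⁆ zero    zero    x≢y = ⊥-elim (x≢y refl)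
lookup-⁅y⁆ zero    (suc y) x≢y = refl
lookup-⁅y⁆ (suc x) zero    x≢y = lookup-∅ x
lookup-⁅y⁆ (suc x) (suc y) x≢y = lookup-⁅y⁆ x y (x≢y ∘ cong suc)

lookup-⁅y⁆⇒≡ : (x y : Fin n) → Vec.lookup ⁅ y ⁆ x ≡ true → x ≡ y
lookup-⁅y⁆⇒≡ x y x∈ with x ≟ y
... | yes x≡y = x≡y
... | no  x≢y with () ← trans (sym x∈) (lookup-⁅y⁆ x y x≢y)

lookup-∪⁻ : (p q : Subset n) (x : Fin n) → Vec.lookup (p ∪ q) x ≡ true →
            Vec.lookup p x ≡ true ⊎ Vec.lookup q x ≡ true
lookup-∪⁻ p q x x∈ with Vec.lookup p x in x∉p
... | true  = inj₁ refl
... | false = inj₂ (trans (sym (trans (lookup-∪ p q x) (cong (_∨ Vec.lookup q x) x∉p))) x∈)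

lookup-∪⁺ˡ : (p q : Subset n) (x : Fin n) → Vec.lookup p x ≡ true → Vec.lookup (p ∪ q) x ≡ true
lookup-∪⁺ˡ p q x x∈ = trans (lookup-∪ p q x) (cong (_∨ Vec.lookup q x) x∈)

lookup-∪⁺ʳ : (p q : Subset n) (x : Fin n) → Vec.lookup q x ≡ true → Vec.lookup (p ∪ q) x ≡ true
lookup-∪⁺ʳ p q x x∈ = trans (lookup-∪ p q x) (trans (cong (Vec.lookup p x ∨_) x∈) (∨-zeroʳ _))

lookup-insert-self : (σ : Subset n) (x : Fin n) → Vec.lookup (σ ∪ ⁅ x ⁆) x ≡ true
lookup-insert-self σ x = lookup-∪⁺ʳ σ ⁅ x ⁆ x (lookup-⁅x⁆ x)

lookup-insert-other : (σ : Subset n) (y x : Fin n) → y ≢ x → Vec.lookup (σ ∪ ⁅ x ⁆) y ≡ Vec.lookup σ y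
lookup-insert-other σ y x y≢x =
  trans (lookup-∪ σ ⁅ x ⁆ y) (trans (cong (Vec.lookup σ y ∨_) (lookup-⁅y⁆ y x y≢x)) (∨-identityʳ _))

lookup-insert⁺ : (σ : Subset n) (y x : Fin n) → Vec.lookup σ y ≡ true → Vec.lookup (σ ∪ ⁅ x ⁆) y ≡ true
lookup-insert⁺ σ y x = lookup-∪⁺ˡ σ ⁅ x ⁆ y

lookup-remove-self : (σ : Subset n) (x : Fin n) → Vec.lookup (σ - x) x ≡ false
lookup-remove-self (s ∷ σ) zero    = refl
lookup-remove-self (s ∷ σ) (suc x) = lookup-remove-self σ x

lookup-remove-other : (σ : Subset n) (y x : Fin n) → y ≢ x → Vec.lookup (σ - x) y ≡ Vec.lookup σ y
lookup-remove-other (s ∷ σ) zero    zero    y≢x = ⊥-elim (y≢x refl)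
lookup-remove-other (s ∷ σ) zero    (suc x) y≢x = refl
lookup-remove-other (s ∷ σ) (suc y) zero    y≢x = cong (λ τ → Vec.lookup τ y) (p─⊥≡p σ)
lookup-remove-other (s ∷ σ) (suc y) (suc x) y≢x = lookup-remove-other σ y x (y≢x ∘ cong suc)

remove-insert : (σ : Subset n) (x : Fin n) → Vec.lookup σ x ≡ false → (σ ∪ ⁅ x ⁆) - x ≡ σ
remove-insert σ x x∉σ = lookup-ext _ _ pointwise
  where
  pointwise : ∀ y → Vec.lookup ((σ ∪ ⁅ x ⁆) - x) y ≡ Vec.lookup σ y
  pointwise y with y ≟ x
  ... | yes refl = trans (lookup-remove-self (σ ∪ ⁅ x ⁆) y) (sym x∉σ)
  ... | no  y≢x  = trans (lookup-remove-other (σ ∪ ⁅ x ⁆) y x y≢x) (lookup-insert-other σ y x y≢x)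

insert-remove : (σ : Subset n) (x : Fin n) → Vec.lookup σ x ≡ true → (σ - x) ∪ ⁅ x ⁆ ≡ σ
insert-remove σ x x∈σ = lookup-ext _ _ pointwise
  where
  pointwise : ∀ y → Vec.lookup ((σ - x) ∪ ⁅ x ⁆) y ≡ Vec.lookup σ y
  pointwise y with y ≟ x
  ... | yes refl = trans (lookup-insert-self (σ - x) y) (sym x∈σ)
  ... | no  y≢x  = trans (lookup-insert-other (σ - x) y x y≢x) (lookup-remove-other σ y x y≢x)

remove-insert-comm : (σ : Subset n) (x v : Fin n) → v ≢ x → (σ ∪ ⁅ v ⁆) - x ≡ (σ - x) ∪ ⁅ v ⁆
remove-insert-comm σ x v v≢x = lookup-ext _ _ pointwise
  where
  pointwise : ∀ y → Vec.lookup ((σ ∪ ⁅ v ⁆) - x) y ≡ Vec.lookup ((σ - x) ∪ ⁅ v ⁆) y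
  pointwise y with y ≟ x | y ≟ v
  ... | yes refl | yes refl = ⊥-elim (v≢x refl)
  ... | yes refl | no  y≢v  = trans (lookup-remove-self (σ ∪ ⁅ v ⁆) y)
                                (sym (trans (lookup-insert-other (σ - y) y v y≢v) (lookup-remove-self σ y)))
  ... | no  y≢x  | yes refl = trans (lookup-remove-other (σ ∪ ⁅ y ⁆) y x y≢x)
                                (trans (lookup-insert-self σ y) (sym (lookup-insert-self (σ - x) y)))
  ... | no  y≢x  | no  y≢v  = begin
    Vec.lookup ((σ ∪ ⁅ v ⁆) - x) y  ≡⟨ lookup-remove-other (σ ∪ ⁅ v ⁆) y x y≢x ⟩
    Vec.lookup (σ ∪ ⁅ v ⁆) y        ≡⟨ lookup-insert-other σ y v y≢v ⟩
    Vec.lookup σ y                  ≡⟨ lookup-remove-other σ y x y≢x ⟨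
    Vec.lookup (σ - x) y            ≡⟨ lookup-insert-other (σ - x) y v y≢v ⟨
    Vec.lookup ((σ - x) ∪ ⁅ v ⁆) y  ∎
    where open ≡-Reasoning

infix 4 _⊆_

_⊆_ : Subset n → Subset n → Set
σ ⊆ τ = ∀ v → Vec.lookup σ v ≡ true → Vec.lookup τ v ≡ true

⊆-refl : (σ : Subset n) → σ ⊆ σ
⊆-refl σ v v∈σ = v∈σ

∅⊆ : (σ : Subset n) → ∅ ⊆ σ
∅⊆ σ v v∈∅ with () ← trans (sym v∈∅) (lookup-∅ v)

⁅x⁆⊆ : (σ : Subset n) (x : Fin n) → Vec.lookup σ x ≡ true → ⁅ x ⁆ ⊆ σ
⁅x⁆⊆ σ x x∈σ v v∈⁅x⁆ rewrite lookup-⁅y⁆⇒≡ v x v∈⁅x⁆ = x∈σ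

lookup-insert⁻ : (σ : Subset n) (v x : Fin n) → Vec.lookup (σ ∪ ⁅ x ⁆) v ≡ true →
                 Vec.lookup σ v ≡ true ⊎ v ≡ x
lookup-insert⁻ σ v x v∈ with lookup-∪⁻ σ ⁅ x ⁆ v v∈
... | inj₁ v∈σ   = inj₁ v∈σ
... | inj₂ v∈⁅x⁆ = inj₂ (lookup-⁅y⁆⇒≡ v x v∈⁅x⁆)

lookup-pair⁻ : (u v w : Fin n) → Vec.lookup (⁅ u ⁆ ∪ ⁅ v ⁆) w ≡ true → w ≡ u ⊎ w ≡ v
lookup-pair⁻ u v w w∈ with lookup-insert⁻ ⁅ u ⁆ w v w∈
... | inj₁ w∈⁅u⁆ = inj₁ (lookup-⁅y⁆⇒≡ w u w∈⁅u⁆)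
... | inj₂ w≡v   = inj₂ w≡v

∈pairˡ : (u v : Fin n) → Vec.lookup (⁅ u ⁆ ∪ ⁅ v ⁆) u ≡ true
∈pairˡ u v = lookup-insert⁺ ⁅ u ⁆ u v (lookup-⁅x⁆ u)

∈pairʳ : (u v : Fin n) → Vec.lookup (⁅ u ⁆ ∪ ⁅ v ⁆) v ≡ true
∈pairʳ u v = lookup-insert-self ⁅ u ⁆ v

pair⊆ : (σ : Subset n) (u v : Fin n) → Vec.lookup σ u ≡ true → Vec.lookup σ v ≡ true → (⁅ u ⁆ ∪ ⁅ v ⁆) ⊆ σ
pair⊆ σ u v u∈σ v∈σ w w∈ with lookup-insert⁻ ⁅ u ⁆ w v w∈
... | inj₁ w∈⁅u⁆ = ⁅x⁆⊆ σ u u∈σ w w∈⁅u⁆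
... | inj₂ refl  = v∈σ

pair-swap⊆ : (u v : Fin n) → (⁅ u ⁆ ∪ ⁅ v ⁆) ⊆ (⁅ v ⁆ ∪ ⁅ u ⁆)
pair-swap⊆ u v = pair⊆ (⁅ v ⁆ ∪ ⁅ u ⁆) u v (∈pairʳ v u) (∈pairˡ v u)

⊆-insert : (σ : Subset n) (x : Fin n) → σ ⊆ σ ∪ ⁅ x ⁆
⊆-insert σ x v = lookup-insert⁺ σ v x

insert-mono : (σ τ : Subset n) (x : Fin n) → σ ⊆ τ → σ ∪ ⁅ x ⁆ ⊆ τ ∪ ⁅ x ⁆
insert-mono σ τ x σ⊆τ v v∈ with lookup-insert⁻ σ v x v∈
... | inj₁ v∈σ = lookup-insert⁺ τ v x (σ⊆τ v v∈σ)
... | inj₂ refl = lookup-insert-self τ v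

∑ : {A : Set} → List A → (A → ℤ) → ℤ
∑ xs f = foldr (λ x s → f x ℤ.+ s) 0ℤ xs

module _ {A : Set} where

  ∑-cong : (xs : List A) {f g : A → ℤ} → f ≗ g → ∑ xs f ≡ ∑ xs g
  ∑-cong []       f≗g = refl
  ∑-cong (x ∷ xs) f≗g = cong₂ ℤ._+_ (f≗g x) (∑-cong xs f≗g)

  ∑-zero : (xs : List A) {f : A → ℤ} → (∀ x → f x ≡ 0ℤ) → ∑ xs f ≡ 0ℤ
  ∑-zero []       f≡0 = refl
  ∑-zero (x ∷ xs) f≡0 = cong₂ ℤ._+_ (f≡0 x) (∑-zero xs f≡0)

  ∑-+ : (xs : List A) (f g : A → ℤ) → ∑ xs (λ x → f x ℤ.+ g x) ≡ ∑ xs f ℤ.+ ∑ xs g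
  ∑-+ []       f g = refl
  ∑-+ (x ∷ xs) f g rewrite ∑-+ xs f g = +-interchange (f x) (g x) (∑ xs f) (∑ xs g)

  ∑-neg : (xs : List A) (f : A → ℤ) → ∑ xs (λ x → - f x) ≡ - ∑ xs f
  ∑-neg []       f = refl
  ∑-neg (x ∷ xs) f rewrite ∑-neg xs f = sym (ℤ.neg-distrib-+ (f x) (∑ xs f))

∑-tabulate : ∀ {m} (g : Fin m → Fin n) (f : Fin n → ℤ) → ∑ (List.tabulate g) f ≡ ∑ (allFin m) (f ∘ g)
∑-tabulate {m = ℕ.zero}  g f = refl
∑-tabulate {m = ℕ.suc m} g f =
  cong (ℤ._+_ (f (g zero))) (trans (∑-tabulate (g ∘ suc) f) (sym (∑-tabulate suc (f ∘ g))))

sumFin-suc : (f : Fin (ℕ.suc n) → ℤ) → sumFin f ≡ f zero ℤ.+ sumFin (f ∘ suc)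
sumFin-suc f = cong (ℤ._+_ (f zero)) (∑-tabulate suc f)

sumFin-single : (f : Fin n → ℤ) (x : Fin n) → (∀ y → y ≢ x → f y ≡ 0ℤ) → sumFin f ≡ f x
sumFin-single {ℕ.suc n} f zero    f≡0 = begin
  sumFin f                     ≡⟨ sumFin-suc f ⟩
  f zero ℤ.+ sumFin (f ∘ suc)  ≡⟨ cong (ℤ._+_ (f zero)) (∑-zero (allFin n) (λ y → f≡0 (suc y) λ ())) ⟩
  f zero ℤ.+ 0ℤ                ≡⟨ ℤ.+-identityʳ (f zero) ⟩
  f zero                       ∎
  where open ≡-Reasoning
sumFin-single {ℕ.suc n} f (suc x) f≡0 = begin
  sumFin f                     ≡⟨ sumFin-suc f ⟩
  f zero ℤ.+ sumFin (f ∘ suc)  ≡⟨ cong₂ ℤ._+_ (f≡0 zero λ ()) (sumFin-single (f ∘ suc) x tail≡0) ⟩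
  0ℤ ℤ.+ f (suc x)             ≡⟨ ℤ.+-identityˡ (f (suc x)) ⟩
  f (suc x)                    ∎
  where
  open ≡-Reasoning
  tail≡0 : ∀ y → y ≢ x → f (suc y) ≡ 0ℤ
  tail≡0 y y≢x = f≡0 (suc y) (y≢x ∘ suc-injective)

countᵇ : {A : Set} → List A → (A → Bool) → ℕ
countᵇ xs p = length (List.filterᵇ p xs)

countᵇ-zero-or : {A : Set} (xs : List A) (p : A → Bool) → countᵇ xs p ≡ 0 ⊎ ∃ λ x → p x ≡ true
countᵇ-zero-or []       p = inj₁ refl
countᵇ-zero-or (x ∷ xs) p with p x in px
... | true  = inj₂ (x , px)
... | false = countᵇ-zero-or xs p

countᵇ-cong : {A : Set} (xs : List A) {p q : A → Bool} → p ≗ q → countᵇ xs p ≡ countᵇ xs q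
countᵇ-cong []       p≗q = refl
countᵇ-cong (x ∷ xs) {p} {q} p≗q with p x | q x | p≗q x
... | true  | true  | refl = cong ℕ.suc (countᵇ-cong xs p≗q)
... | false | false | refl = countᵇ-cong xs p≗q

countᵇ-tabulate : ∀ {m} (g : Fin m → Fin n) (p : Fin n → Bool) →
                  countᵇ (List.tabulate g) p ≡ countᵇ (allFin m) (p ∘ g)
countᵇ-tabulate {m = ℕ.zero}  g p = refl
countᵇ-tabulate {m = ℕ.suc m} g p with p (g zero)
... | true  = cong ℕ.suc (trans (countᵇ-tabulate (g ∘ suc) p) (sym (countᵇ-tabulate suc (p ∘ g))))
... | false = trans (countᵇ-tabulate (g ∘ suc) p) (sym (countᵇ-tabulate suc (p ∘ g)))

countᵇ-allFin-insert : (p q : Fin n → Bool) (x : Fin n) → p x ≡ true → q x ≡ false →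
                       (∀ y → y ≢ x → p y ≡ q y) → countᵇ (allFin n) p ≡ ℕ.suc (countᵇ (allFin n) q)
countᵇ-allFin-insert {ℕ.suc n} p q zero px qx p≗q rewrite px | qx =
  cong ℕ.suc (trans (countᵇ-tabulate suc p)
    (trans (countᵇ-cong (allFin n) (λ y → p≗q (suc y) λ ())) (sym (countᵇ-tabulate suc q))))
countᵇ-allFin-insert {ℕ.suc n} p q (suc x) px qx p≗q =
  step (countᵇ-allFin-insert (p ∘ suc) (q ∘ suc) x px qx (λ y y≢x → p≗q (suc y) (y≢x ∘ suc-injective)))
  where
  tail : countᵇ (allFin n) (p ∘ suc) ≡ ℕ.suc (countᵇ (allFin n) (q ∘ suc)) →
         countᵇ (List.tabulate suc) p ≡ ℕ.suc (countᵇ (List.tabulate suc) q)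
  tail ih = trans (countᵇ-tabulate suc p) (trans ih (cong ℕ.suc (sym (countᵇ-tabulate suc q))))
  step : countᵇ (allFin n) (p ∘ suc) ≡ ℕ.suc (countᵇ (allFin n) (q ∘ suc)) →
         countᵇ (allFin (ℕ.suc n)) p ≡ ℕ.suc (countᵇ (allFin (ℕ.suc n)) q)
  step ih with p zero | q zero | p≗q zero (λ ())
  ... | true  | true  | refl = cong ℕ.suc (tail ih)
  ... | false | false | refl = tail ih

-- Square-free monomial ideals, colon ideals, cones and domination

-- SqIdeal admits any Boolean function; upward closure of monomial ideals is assumed where needed.
UpClosed : SqIdeal n → Set
UpClosed {n} I = ∀ (σ τ : Subset n) → σ ⊆ τ → I σ ≡ true → I τ ≡ true

GeneratedInDegree≤2 : SqIdeal n → Set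
GeneratedInDegree≤2 {n} I = ∀ (σ : Subset n) → I σ ≡ true →
  I ∅ ≡ true ⊎ ∃₂ λ u v → Vec.lookup σ u ≡ true × Vec.lookup σ v ≡ true × I (⁅ u ⁆ ∪ ⁅ v ⁆) ≡ true

module _ (I : SqIdeal n) (x : Fin n) (I-up : UpClosed I) where

  colon-upClosed : UpClosed (colon I x)
  colon-upClosed σ τ σ⊆τ σ∈ with Vec.lookup σ x in x∈σ
  ... | true rewrite σ⊆τ x x∈σ = refl
  ... | false with Vec.lookup τ x
  ...   | true  = refl
  ...   | false = I-up (σ ∪ ⁅ x ⁆) (τ ∪ ⁅ x ⁆) (insert-mono σ τ x σ⊆τ) σ∈

  colon-⊇ : ∀ σ → I σ ≡ true → colon I x σ ≡ true
  colon-⊇ σ σ∈I with Vec.lookup σ x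
  ... | true  = refl
  ... | false = I-up σ (σ ∪ ⁅ x ⁆) (⊆-insert σ x) σ∈I

  colon-∅ : colon I x ∅ ≡ I ⁅ x ⁆
  colon-∅ rewrite lookup-∅ x | ∪-identityˡ ⁅ x ⁆ = refl

  colon-intro : ∀ τ ρ → ρ ⊆ τ ∪ ⁅ x ⁆ → I ρ ≡ true → colon I x τ ≡ true
  colon-intro τ ρ ρ⊆ ρ∈I with Vec.lookup τ x
  ... | true  = refl
  ... | false = I-up ρ (τ ∪ ⁅ x ⁆) ρ⊆ ρ∈I

  colon-link : ∀ u → I (⁅ u ⁆ ∪ ⁅ x ⁆) ≡ true → colon I x (⁅ u ⁆ ∪ ⁅ u ⁆) ≡ true
  colon-link u ux∈I = colon-intro (⁅ u ⁆ ∪ ⁅ u ⁆) (⁅ u ⁆ ∪ ⁅ x ⁆) ux⊆ ux∈I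
    where
    ux⊆ : ⁅ u ⁆ ∪ ⁅ x ⁆ ⊆ (⁅ u ⁆ ∪ ⁅ u ⁆) ∪ ⁅ x ⁆
    ux⊆ = pair⊆ ((⁅ u ⁆ ∪ ⁅ u ⁆) ∪ ⁅ x ⁆) u x
            (lookup-insert⁺ (⁅ u ⁆ ∪ ⁅ u ⁆) u x (∈pairʳ u u)) (lookup-insert-self (⁅ u ⁆ ∪ ⁅ u ⁆) x)

  colon-degree≤2 : GeneratedInDegree≤2 I → GeneratedInDegree≤2 (colon I x)
  colon-degree≤2 I-gen σ σ∈ with Vec.lookup σ x in x∈σ
  ... | true = inj₂ (x , x , x∈σ , x∈σ , cong (_∨ I ((⁅ x ⁆ ∪ ⁅ x ⁆) ∪ ⁅ x ⁆)) (lookup-insert-self ⁅ x ⁆ x))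
  ... | false with I-gen (σ ∪ ⁅ x ⁆) σ∈
  ...   | inj₁ ∅∈I = inj₁ (colon-intro ∅ ∅ (∅⊆ (∅ ∪ ⁅ x ⁆)) ∅∈I)
  ...   | inj₂ (u , v , u∈ , v∈ , uv∈I) with lookup-insert⁻ σ u x u∈ | lookup-insert⁻ σ v x v∈
  ...     | inj₁ u∈σ | inj₁ v∈σ = inj₂ (u , v , u∈σ , v∈σ , colon-⊇ (⁅ u ⁆ ∪ ⁅ v ⁆) uv∈I)
  ...     | inj₁ u∈σ | inj₂ refl = inj₂ (u , u , u∈σ , u∈σ , colon-link u uv∈I)
  ...     | inj₂ refl | inj₁ v∈σ =
    inj₂ (v , v , v∈σ , v∈σ , colon-link v (I-up (⁅ x ⁆ ∪ ⁅ v ⁆) (⁅ v ⁆ ∪ ⁅ x ⁆) (pair-swap⊆ x v) uv∈I))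
  ...     | inj₂ refl | inj₂ refl =
    inj₁ (colon-intro ∅ (⁅ x ⁆ ∪ ⁅ x ⁆) (pair⊆ (∅ ∪ ⁅ x ⁆) x x x∈ x∈) uv∈I)
    where
    x∈ : Vec.lookup (∅ ∪ ⁅ x ⁆) x ≡ true
    x∈ = lookup-insert-self ∅ x

module _ (I : SqIdeal n) (I-up : UpClosed I) (I-gen : GeneratedInDegree≤2 I) (∅∉I : I ∅ ≡ false) where

  isCone-criterion : (x : Fin n) → I ⁅ x ⁆ ≡ false →
                     (∀ y → y ≢ x → I ⁅ y ⁆ ≡ false → I (⁅ y ⁆ ∪ ⁅ x ⁆) ≡ false) → IsCone I x
  isCone-criterion x x∉I isolated σ with Vec.lookup σ x in x∉σ
  ... | true = sym (∨-zeroʳ (I σ))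
  ... | false rewrite ∨-identityʳ (I σ) with I σ in σ∈?I
  ...   | true  = I-up σ (σ ∪ ⁅ x ⁆) (⊆-insert σ x) σ∈?I
  ...   | false = ¬-not λ σx∈I → no-generator (I-gen (σ ∪ ⁅ x ⁆) σx∈I)
    where
    outside : ∀ ρ → ρ ⊆ σ → I ρ ≡ false
    outside ρ ρ⊆σ = ¬-not λ ρ∈I → absurdᵇ (I-up ρ σ ρ⊆σ ρ∈I) σ∈?I
    isolated-in-σ : ∀ y → Vec.lookup σ y ≡ true → I (⁅ y ⁆ ∪ ⁅ x ⁆) ≡ false
    isolated-in-σ y y∈σ = isolated y (λ y≡x → absurdᵇ (subst (λ z → Vec.lookup σ z ≡ true) y≡x y∈σ) x∉σ)
                                     (outside ⁅ y ⁆ (⁅x⁆⊆ σ y y∈σ))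
    no-generator : I ∅ ≡ true ⊎ ∃₂ (λ u v → Vec.lookup (σ ∪ ⁅ x ⁆) u ≡ true ×
                                           Vec.lookup (σ ∪ ⁅ x ⁆) v ≡ true × I (⁅ u ⁆ ∪ ⁅ v ⁆) ≡ true) → ⊥
    no-generator (inj₁ ∅∈I) = absurdᵇ ∅∈I ∅∉I
    no-generator (inj₂ (u , v , u∈ , v∈ , uv∈I)) with lookup-insert⁻ σ u x u∈ | lookup-insert⁻ σ v x v∈
    ... | inj₁ u∈σ  | inj₁ v∈σ  = absurdᵇ uv∈I (outside _ (pair⊆ σ u v u∈σ v∈σ))
    ... | inj₁ u∈σ  | inj₂ refl = absurdᵇ uv∈I (isolated-in-σ u u∈σ)
    ... | inj₂ refl | inj₁ v∈σ  = absurdᵇ (I-up _ _ (pair-swap⊆ x v) uv∈I) (isolated-in-σ v v∈σ)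
    ... | inj₂ refl | inj₂ refl = absurdᵇ (I-up _ _ (pair⊆ ⁅ x ⁆ x x (lookup-⁅x⁆ x) (lookup-⁅x⁆ x)) uv∈I) x∉I

record DominationFacts (I : SqIdeal n) (a b : Fin n) : Set where
  field
    a≢b        : a ≢ b
    b∉I        : I ⁅ b ⁆ ≡ false
    ab∈I       : I (⁅ a ⁆ ∪ ⁅ b ⁆) ≡ true
    cone-off-a : ∀ σ → Vec.lookup σ a ≡ false → Vec.lookup σ b ≡ false → I (σ ∪ ⁅ b ⁆) ≡ I σ

module _ (I : SqIdeal n) (I-up : UpClosed I) (I-gen : GeneratedInDegree≤2 I) (∅∉I : I ∅ ≡ false) where

  domination-facts : (a b : Fin n) → Dominates I a b → DominationFacts I a b
  domination-facts a b (b-not-apex , b-apex) =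
    record { a≢b = a≢b ; b∉I = b∉I ; ab∈I = ab∈I ; cone-off-a = cone-off-a }
    where
    open ≡-Reasoning
    apex-off-a : ∀ σ → Vec.lookup σ a ≡ false → Vec.lookup σ b ≡ false → addVar I a (σ ∪ ⁅ b ⁆) ≡ I σ
    apex-off-a σ a∉σ b∉σ = begin
      addVar I a (σ ∪ ⁅ b ⁆)   ≡⟨ cong (_∨ addVar I a (σ ∪ ⁅ b ⁆)) b∉σ ⟨
      colon (addVar I a) b σ   ≡⟨ b-apex σ ⟩
      addVar (addVar I a) b σ  ≡⟨ cong₂ (λ p q → (I σ ∨ p) ∨ q) a∉σ b∉σ ⟩
      (I σ ∨ false) ∨ false    ≡⟨ trans (∨-identityʳ _) (∨-identityʳ _) ⟩
      I σ                      ∎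
    at-∅ : addVar I a (∅ ∪ ⁅ b ⁆) ≡ false
    at-∅ = trans (apex-off-a ∅ (lookup-∅ a) (lookup-∅ b)) ∅∉I
    b∉I : I ⁅ b ⁆ ≡ false
    b∉I = subst (λ ρ → I ρ ≡ false) (∪-identityˡ ⁅ b ⁆) (∨-conicalˡ _ _ at-∅)
    a≢b : a ≢ b
    a≢b refl = absurdᵇ (lookup-insert-self ∅ a) (∨-conicalʳ _ _ at-∅)
    cone-off-a : ∀ σ → Vec.lookup σ a ≡ false → Vec.lookup σ b ≡ false → I (σ ∪ ⁅ b ⁆) ≡ I σ
    cone-off-a σ a∉σ b∉σ =
      trans (sym (trans (cong (I (σ ∪ ⁅ b ⁆) ∨_) a∉σb) (∨-identityʳ _))) (apex-off-a σ a∉σ b∉σ)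
      where
      a∉σb : Vec.lookup (σ ∪ ⁅ b ⁆) a ≡ false
      a∉σb = trans (lookup-insert-other σ a b a≢b) a∉σ
    ab∈I : I (⁅ a ⁆ ∪ ⁅ b ⁆) ≡ true
    ab∈I with I (⁅ a ⁆ ∪ ⁅ b ⁆) in ab∉I
    ... | true  = refl
    ... | false = ⊥-elim (b-not-apex (isCone-criterion I I-up I-gen ∅∉I b b∉I isolated))
      where
      isolated : ∀ y → y ≢ b → I ⁅ y ⁆ ≡ false → I (⁅ y ⁆ ∪ ⁅ b ⁆) ≡ false
      isolated y y≢b y∉I with y ≟ a
      ... | yes refl = ab∉I
      ... | no  y≢a  = trans (cone-off-a ⁅ y ⁆ (lookup-⁅y⁆ a y (y≢a ∘ sym)) (lookup-⁅y⁆ b y (y≢b ∘ sym))) y∉I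

module _ (J : SqIdeal n) (p : Fin n) where

  addVar-upClosed : UpClosed J → UpClosed (addVar J p)
  addVar-upClosed J-up σ τ σ⊆τ σ∈ with J σ in σ∈J | Vec.lookup σ p in p∈σ
  ... | true  | _    rewrite J-up σ τ σ⊆τ σ∈J = refl
  ... | false | true rewrite σ⊆τ p p∈σ = ∨-zeroʳ (J τ)

  addVar-degree≤2 : GeneratedInDegree≤2 J → GeneratedInDegree≤2 (addVar J p)
  addVar-degree≤2 J-gen σ σ∈ with J σ in σ∈J | Vec.lookup σ p in p∈σ
  ... | false | true = inj₂ (p , p , p∈σ , p∈σ , trans (cong (J (⁅ p ⁆ ∪ ⁅ p ⁆) ∨_) (∈pairʳ p p)) (∨-zeroʳ _))
  ... | true  | _ with J-gen σ σ∈J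
  ...   | inj₁ ∅∈J = inj₁ (cong (_∨ Vec.lookup ∅ p) ∅∈J)
  ...   | inj₂ (u , v , u∈σ , v∈σ , uv∈J) =
    inj₂ (u , v , u∈σ , v∈σ , cong (_∨ Vec.lookup (⁅ u ⁆ ∪ ⁅ v ⁆) p) uv∈J)

colonProd-⊇ : (J : SqIdeal n) → UpClosed J → ∀ A σ → J σ ≡ true → colonProd J A σ ≡ true
colonProd-⊇ J J-up []      σ σ∈J = σ∈J
colonProd-⊇ J J-up (x ∷ A) σ σ∈J =
  colonProd-⊇ (colon J x) (colon-upClosed J x J-up) A σ (colon-⊇ J x J-up σ σ∈J)

colonProd-upClosed : (J : SqIdeal n) → UpClosed J → ∀ A → UpClosed (colonProd J A)
colonProd-upClosed J J-up []      = J-up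
colonProd-upClosed J J-up (x ∷ A) = colonProd-upClosed (colon J x) (colon-upClosed J x J-up) A

colonProd-degree≤2 : (J : SqIdeal n) → UpClosed J → GeneratedInDegree≤2 J →
                     ∀ A → GeneratedInDegree≤2 (colonProd J A)
colonProd-degree≤2 J J-up J-gen []      = J-gen
colonProd-degree≤2 J J-up J-gen (x ∷ A) =
  colonProd-degree≤2 (colon J x) (colon-upClosed J x J-up) (colon-degree≤2 J x J-up J-gen) A

var∉⇒∅∉ : (J : SqIdeal n) (x : Fin n) → UpClosed J → J ⁅ x ⁆ ≡ false → J ∅ ≡ false
var∉⇒∅∉ J x J-up x∉J = ¬-not λ ∅∈J → absurdᵇ (J-up ∅ ⁅ x ⁆ (∅⊆ ⁅ x ⁆) ∅∈J) x∉J

colonProd-∅ : (J : SqIdeal n) (A : List (Fin n)) → UpClosed J → J ∅ ≡ false →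
              (∀ i → ¬ (lookup A i ∈I stage J A i)) → colonProd J A ∅ ≡ false
colonProd-∅ J []      J-up ∅∉J a∉ = ∅∉J
colonProd-∅ J (a ∷ A) J-up ∅∉J a∉ =
  colonProd-∅ (colon J a) A (colon-upClosed J a J-up) (trans (colon-∅ J a J-up) (¬-not (a∉ zero))) (a∉ ∘ suc)

-- Chains, the boundary of the full simplex and the Leibniz rule

permutation-injective : (π : Permutation′ n) → Injective _≡_ _≡_ (π ⟨$⟩ʳ_)
permutation-injective π eq = trans (sym (inverseˡ π)) (trans (cong (π ⟨$⟩ˡ_) eq) (inverseˡ π))

rank-injective : (π : Permutation′ n) {u v : Fin n} → rank π u ≡ rank π v → u ≡ v
rank-injective π eq = permutation-injective π (toℕ-injective eq)

below-zero-or : (π : Permutation′ n) (σ : Subset n) (v : Fin n) →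
                below π σ v ≡ 0 ⊎ ∃ λ u → Vec.lookup σ u ≡ true × rank π u ℕ.< rank π v
below-zero-or π σ v with countᵇ-zero-or (allFin _) (λ u → Vec.lookup σ u ∧ (rank π u ℕ.<ᵇ rank π v))
... | inj₁ none            = inj₁ none
... | inj₂ (u , u-below) =
  inj₂ (u , ∧-conicalˡ _ _ u-below , ℕ.<ᵇ⇒< _ _ (Equivalence.from T-≡ (∧-conicalʳ _ _ u-below)))

below-insert : (π : Permutation′ n) (τ : Subset n) (x v : Fin n) → Vec.lookup τ x ≡ false →
               rank π x ℕ.< rank π v → below π (τ ∪ ⁅ x ⁆) v ≡ ℕ.suc (below π τ v)
below-insert π τ x v x∉τ x<v = countᵇ-allFin-insert _ _ x
  (cong₂ _∧_ (lookup-insert-self τ x) (Equivalence.to T-≡ (ℕ.<⇒<ᵇ x<v)))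
  (cong (_∧ _) x∉τ)
  (λ u u≢x → cong (_∧ _) (lookup-insert-other τ u x u≢x))

∂-term : Permutation′ n → Chain n → Subset n → Fin n → ℤ
∂-term π c σ v = if Vec.lookup σ v then 0ℤ else negPow (below π σ v) ℤ.* c (σ ∪ ⁅ v ⁆)

∂ : Permutation′ n → Chain n → Chain n
∂ π c σ = sumFin (∂-term π c σ)

module _ (π : Permutation′ n) where

  ∂-local : (f g : Chain n) (σ : Subset n) →
            (∀ v → Vec.lookup σ v ≡ false → f (σ ∪ ⁅ v ⁆) ≡ g (σ ∪ ⁅ v ⁆)) → ∂ π f σ ≡ ∂ π g σ
  ∂-local f g σ f≡g = ∑-cong (allFin _) term
    where
    term : ∀ v → ∂-term π f σ v ≡ ∂-term π g σ v
    term v with Vec.lookup σ v in v∉σ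
    ... | true  = refl
    ... | false = cong (negPow (below π σ v) ℤ.*_) (f≡g v v∉σ)

  ∂-cong : {f g : Chain n} → f ≗ g → ∂ π f ≗ ∂ π g
  ∂-cong {f} {g} f≗g σ = ∂-local f g σ (λ v _ → f≗g (σ ∪ ⁅ v ⁆))

  ∂-zero : (f : Chain n) (σ : Subset n) →
           (∀ v → Vec.lookup σ v ≡ false → f (σ ∪ ⁅ v ⁆) ≡ 0ℤ) → ∂ π f σ ≡ 0ℤ
  ∂-zero f σ f≡0 = ∑-zero (allFin _) term
    where
    term : ∀ v → ∂-term π f σ v ≡ 0ℤ
    term v with Vec.lookup σ v in v∉σ
    ... | true  = refl
    ... | false = trans (cong (negPow (below π σ v) ℤ.*_) (f≡0 v v∉σ)) (ℤ.*-zeroʳ (negPow (below π σ v)))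

  ∂-+ : (f g : Chain n) (σ : Subset n) → ∂ π (λ ρ → f ρ ℤ.+ g ρ) σ ≡ ∂ π f σ ℤ.+ ∂ π g σ
  ∂-+ f g σ = trans (∑-cong (allFin _) term) (∑-+ (allFin _) (∂-term π f σ) (∂-term π g σ))
    where
    term : ∀ v → ∂-term π (λ ρ → f ρ ℤ.+ g ρ) σ v ≡ ∂-term π f σ v ℤ.+ ∂-term π g σ v
    term v with Vec.lookup σ v
    ... | true  = refl
    ... | false = ℤ.*-distribˡ-+ (negPow (below π σ v)) _ _

  ∂-neg : (f : Chain n) (σ : Subset n) → ∂ π (λ ρ → - f ρ) σ ≡ - ∂ π f σ
  ∂-neg f σ = trans (∑-cong (allFin _) term) (∑-neg (allFin _) (∂-term π f σ))
    where
    term : ∀ v → ∂-term π (λ ρ → - f ρ) σ v ≡ - ∂-term π f σ v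
    term v with Vec.lookup σ v
    ... | true  = refl
    ... | false = sym (ℤ.neg-distribʳ-* (negPow (below π σ v)) _)

boundary≗∂ : (I : SqIdeal n) (π : Permutation′ n) (c : Chain n) → UpClosed I → Supported I c →
             boundary I π c ≗ ∂ π c
boundary≗∂ I π c I-up c-sup σ with I σ in σ∈I
... | false = refl
... | true  = sym (∂-zero π c σ (λ v _ → c-sup _ (I-up σ _ (λ u → lookup-insert⁺ σ u v) σ∈I)))

mulVar : Fin n → Chain n → Chain n
mulVar x w σ = if Vec.lookup σ x then w (σ - x) else 0ℤ

SupportedAbove : Permutation′ n → ℕ → Chain n → Set
SupportedAbove {n} π k w = ∀ (σ : Subset n) u → Vec.lookup σ u ≡ true → rank π u ℕ.≤ k → w σ ≡ 0ℤ

module _ (π : Permutation′ n) (x : Fin n) (w : Chain n) (w-above : SupportedAbove π (rank π x) w) where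

  ∂-term-mulVar : (σ : Subset n) → Vec.lookup σ x ≡ true → (v : Fin n) →
                  ∂-term π (mulVar x w) σ v ≡ - ∂-term π w (σ - x) v
  ∂-term-mulVar σ x∈σ v with v ≟ x
  ... | yes refl rewrite x∈σ | lookup-remove-self σ v | insert-remove σ v x∈σ | w-above σ v x∈σ ℕ.≤-refl
                       | ℤ.*-zeroʳ (negPow (below π (σ - v) v)) = refl
  ... | no v≢x with Vec.lookup σ v in v∈?σ
  ...   | true  rewrite lookup-remove-other σ v x v≢x | v∈?σ = refl
  ...   | false rewrite lookup-remove-other σ v x v≢x | v∈?σ | lookup-insert⁺ σ x v x∈σ
                      | remove-insert-comm σ x v v≢x with ℕ.<-cmp (rank π v) (rank π x)
  ...     | tri≈ _ v≡x _ = ⊥-elim (v≢x (rank-injective π v≡x))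
  ...     | tri< v<x _ _ rewrite w-above ((σ - x) ∪ ⁅ v ⁆) v (lookup-insert-self (σ - x) v) (ℕ.<⇒≤ v<x) =
    trans (ℤ.*-zeroʳ (negPow (below π σ v))) (cong -_ (sym (ℤ.*-zeroʳ (negPow (below π (σ - x) v)))))
  ...     | tri> _ _ x<v = begin
    negPow (below π σ v) ℤ.* w τv          ≡⟨ cong (λ k → negPow k ℤ.* w τv) below-σ ⟩
    - negPow (below π (σ - x) v) ℤ.* w τv  ≡⟨ ℤ.neg-distribˡ-* (negPow (below π (σ - x) v)) (w τv) ⟨
    - (negPow (below π (σ - x) v) ℤ.* w τv) ∎
    where
    open ≡-Reasoning
    τv : Subset n
    τv = (σ - x) ∪ ⁅ v ⁆
    below-σ : below π σ v ≡ ℕ.suc (below π (σ - x) v)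
    below-σ = trans (cong (λ τ → below π τ v) (sym (insert-remove σ x x∈σ)))
                    (below-insert π (σ - x) x v (lookup-remove-self σ x) x<v)

  -- As x precedes the support of w: at a face through x, inserting v > x costs one extra sign and
  -- inserting v < x gives 0; at a face avoiding x, only inserting x survives, with sign +1.
  ∂-mulVar : ∀ σ → ∂ π (mulVar x w) σ ≡ w σ ℤ.- mulVar x (∂ π w) σ
  ∂-mulVar σ with Vec.lookup σ x in x∈?σ
  ... | true = begin
    ∂ π (mulVar x w) σ       ≡⟨ ∑-cong (allFin _) (∂-term-mulVar σ x∈?σ) ⟩
    sumFin (λ v → - ∂-term π w (σ - x) v) ≡⟨ ∑-neg (allFin _) (∂-term π w (σ - x)) ⟩
    - ∂ π w (σ - x)          ≡⟨ sym (ℤ.+-identityˡ _) ⟩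
    0ℤ ℤ.- ∂ π w (σ - x)     ≡⟨ cong (ℤ._- ∂ π w (σ - x)) (sym (w-above σ x x∈?σ ℕ.≤-refl)) ⟩
    w σ ℤ.- ∂ π w (σ - x)    ∎
    where open ≡-Reasoning
  ... | false = begin
    ∂ π (mulVar x w) σ       ≡⟨ sumFin-single _ x other-terms ⟩
    ∂-term π (mulVar x w) σ x ≡⟨ x-term ⟩
    w σ                      ≡⟨ sym (ℤ.+-identityʳ (w σ)) ⟩
    w σ ℤ.- 0ℤ               ∎
    where
    open ≡-Reasoning
    other-terms : ∀ v → v ≢ x → ∂-term π (mulVar x w) σ v ≡ 0ℤ
    other-terms v v≢x with Vec.lookup σ v
    ... | true  = refl
    ... | false rewrite lookup-insert-other σ x v (v≢x ∘ sym) | x∈?σ = ℤ.*-zeroʳ (negPow (below π σ v))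
    x-term : ∂-term π (mulVar x w) σ x ≡ w σ
    x-term rewrite x∈?σ | lookup-insert-self σ x | remove-insert σ x x∈?σ with below-zero-or π σ x
    ... | inj₁ none rewrite none = ℤ.*-identityˡ (w σ)
    ... | inj₂ (u , u∈σ , u<x) rewrite w-above σ u u∈σ (ℕ.<⇒≤ u<x) = ℤ.*-zeroʳ (negPow (below π σ x))

module _ (x : Fin n) where

  mulVar-cong : {f g : Chain n} → f ≗ g → mulVar x f ≗ mulVar x g
  mulVar-cong f≗g σ with Vec.lookup σ x
  ... | true  = f≗g (σ - x)
  ... | false = refl

  mulVar-+ : (f g : Chain n) (σ : Subset n) →
             mulVar x (λ ρ → f ρ ℤ.+ g ρ) σ ≡ mulVar x f σ ℤ.+ mulVar x g σ
  mulVar-+ f g σ with Vec.lookup σ x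
  ... | true  = refl
  ... | false = refl

  mulVar-* : (K : ℤ) (f : Chain n) (σ : Subset n) → mulVar x (λ ρ → K ℤ.* f ρ) σ ≡ K ℤ.* mulVar x f σ
  mulVar-* K f σ with Vec.lookup σ x
  ... | true  = refl
  ... | false = sym (ℤ.*-zeroʳ K)

  mulVar-outside : (f : Chain n) (σ : Subset n) → Vec.lookup σ x ≡ false → mulVar x f σ ≡ 0ℤ
  mulVar-outside f σ x∉σ rewrite x∉σ = refl

  mulVar-inside : (f : Chain n) (σ : Subset n) → Vec.lookup σ x ≡ true → mulVar x f σ ≡ f (σ - x)
  mulVar-inside f σ x∈σ rewrite x∈σ = refl

  mulVar-insert : (f : Chain n) (τ : Subset n) → Vec.lookup τ x ≡ false → mulVar x f (τ ∪ ⁅ x ⁆) ≡ f τ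
  mulVar-insert f τ x∉τ rewrite lookup-insert-self τ x | remove-insert τ x x∉τ = refl

  mulVar-vanishes : (f : Chain n) → (∀ τ → Vec.lookup τ x ≡ false → f τ ≡ 0ℤ) → ∀ σ → mulVar x f σ ≡ 0ℤ
  mulVar-vanishes f f≡0 σ with Vec.lookup σ x
  ... | true  = f≡0 (σ - x) (lookup-remove-self σ x)
  ... | false = refl

mulVarDiff : Fin n → Fin n → Chain n → Chain n
mulVarDiff a b z σ = mulVar a z σ ℤ.- mulVar b z σ

mulVarDiff-cong : (a b : Fin n) {f g : Chain n} → f ≗ g → mulVarDiff a b f ≗ mulVarDiff a b g
mulVarDiff-cong a b f≗g σ = cong₂ ℤ._-_ (mulVar-cong a f≗g σ) (mulVar-cong b f≗g σ)

mulVarDiff-linear : (a b : Fin n) (K : ℤ) (f g : Chain n) (σ : Subset n) →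
                    mulVarDiff a b (λ ρ → K ℤ.* f ρ ℤ.+ g ρ) σ ≡
                    K ℤ.* mulVarDiff a b f σ ℤ.+ mulVarDiff a b g σ
mulVarDiff-linear a b K f g σ = begin
  mulVar a (λ ρ → K ℤ.* f ρ ℤ.+ g ρ) σ ℤ.- mulVar b (λ ρ → K ℤ.* f ρ ℤ.+ g ρ) σ
    ≡⟨ cong₂ ℤ._-_ (expand a) (expand b) ⟩
  (K ℤ.* mulVar a f σ ℤ.+ mulVar a g σ) ℤ.- (K ℤ.* mulVar b f σ ℤ.+ mulVar b g σ)
    ≡⟨ solve 5 (λ k fa ga fb gb → (k :* fa :+ ga) :- (k :* fb :+ gb) := k :* (fa :- fb) :+ (ga :- gb))
             refl K (mulVar a f σ) (mulVar a g σ) (mulVar b f σ) (mulVar b g σ) ⟩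
  K ℤ.* mulVarDiff a b f σ ℤ.+ mulVarDiff a b g σ ∎
  where
  open ≡-Reasoning
  expand : ∀ x → mulVar x (λ ρ → K ℤ.* f ρ ℤ.+ g ρ) σ ≡ K ℤ.* mulVar x f σ ℤ.+ mulVar x g σ
  expand x = trans (mulVar-+ x (λ ρ → K ℤ.* f ρ) g σ) (cong (ℤ._+ mulVar x g σ) (mulVar-* x K f σ))

SupportedAbove-mono : (π : Permutation′ n) {j k : ℕ} (w : Chain n) → j ℕ.≤ k →
                      SupportedAbove π k w → SupportedAbove π j w
SupportedAbove-mono π w j≤k w-above σ u u∈σ u≤j = w-above σ u u∈σ (ℕ.≤-trans u≤j j≤k)

∂-vanishes : (π : Permutation′ n) (x : Fin n) (f : Chain n) →
             (∀ σ → Vec.lookup σ x ≡ true → f σ ≡ 0ℤ) → ∀ σ → Vec.lookup σ x ≡ true → ∂ π f σ ≡ 0ℤ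
∂-vanishes π x f f≡0 σ x∈σ = ∂-zero π f σ (λ v _ → f≡0 (σ ∪ ⁅ v ⁆) (lookup-insert⁺ σ x v x∈σ))

HomologousToMultiple : SqIdeal n → Permutation′ n → Chain n → Chain n → Set
HomologousToMultiple {n} I π c z =
  ∃ λ (K : ℤ) → ∃ λ (d : Chain n) → Supported I d × (∀ σ → c σ ≡ K ℤ.* z σ ℤ.+ boundary I π d σ)

CyclesAreMultiplesOf : SqIdeal n → Permutation′ n → Chain n → Set
CyclesAreMultiplesOf {n} I π z =
  ∀ (c : Chain n) → Supported I c → (∀ σ → boundary I π c σ ≡ 0ℤ) → HomologousToMultiple I π c z

HomologyGeneratedBy-cong : (I : SqIdeal n) (π : Permutation′ n) {z z′ : Chain n} → z ≗ z′ →
                           HomologyGeneratedBy I π z → HomologyGeneratedBy I π z′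
HomologyGeneratedBy-cong I π {z} {z′} z≗z′ (z-sup , z-cyc , z-gen) = z′-sup , z′-cyc , z′-gen
  where
  z′-sup : Supported I z′
  z′-sup σ σ∈I = trans (sym (z≗z′ σ)) (z-sup σ σ∈I)
  z′-cyc : ∀ σ → boundary I π z′ σ ≡ 0ℤ
  z′-cyc σ = trans (cong (if I σ then 0ℤ else_) (∂-cong π (sym ∘ z≗z′) σ)) (z-cyc σ)
  z′-gen : CyclesAreMultiplesOf I π z′
  z′-gen c c-sup c-cyc with z-gen c c-sup c-cyc
  ... | K , d , d-sup , c≡ =
    K , d , d-sup , λ σ → trans (c≡ σ) (cong (λ t → K ℤ.* t ℤ.+ boundary I π d σ) (z≗z′ σ))

-- The inductive step: from (I : a) to I

module Step (π : Permutation′ n) (I : SqIdeal n) (I-up : UpClosed I) (a b : Fin n) (k : ℕ)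
  (rank-a : rank π a ≡ k) (rank-b : rank π b ≡ ℕ.suc k)
  (below-k∈I : ∀ u → rank π u ℕ.< k → I ⁅ u ⁆ ≡ true)
  (facts : DominationFacts I a b)
  where

  open DominationFacts facts

  I′ : SqIdeal n
  I′ = colon I a

  I′-up : UpClosed I′
  I′-up = colon-upClosed I a I-up

  rank≤suc-k : ∀ u → rank π u ℕ.≤ ℕ.suc k → rank π u ℕ.< k ⊎ u ≡ a ⊎ u ≡ b
  rank≤suc-k u u≤ with ℕ.m≤n⇒m<n∨m≡n u≤
  ... | inj₂ u≡ = inj₂ (inj₂ (rank-injective π (trans u≡ (sym rank-b))))
  ... | inj₁ (ℕ.s≤s u≤k) with ℕ.m≤n⇒m<n∨m≡n u≤k
  ...   | inj₁ u<k = inj₁ u<k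
  ...   | inj₂ u≡k = inj₂ (inj₁ (rank-injective π (trans u≡k (sym rank-a))))

  ab-faces∈I : ∀ σ → Vec.lookup σ a ≡ true → Vec.lookup σ b ≡ true → I σ ≡ true
  ab-faces∈I σ a∈σ b∈σ = I-up _ σ (pair⊆ σ a b a∈σ b∈σ) ab∈I

  below-k-faces∈I : ∀ σ u → Vec.lookup σ u ≡ true → rank π u ℕ.< k → I σ ≡ true
  below-k-faces∈I σ u u∈σ u<k = I-up ⁅ u ⁆ σ (⁅x⁆⊆ σ u u∈σ) (below-k∈I u u<k)

  below-suc-suc-k∈I′ : ∀ u → rank π u ℕ.< ℕ.suc (ℕ.suc k) → I′ ⁅ u ⁆ ≡ true
  below-suc-suc-k∈I′ u (ℕ.s≤s u≤) with rank≤suc-k u u≤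
  ... | inj₁ u<k         = colon-⊇ I a I-up ⁅ u ⁆ (below-k∈I u u<k)
  ... | inj₂ (inj₁ refl) = cong (_∨ I (⁅ u ⁆ ∪ ⁅ u ⁆)) (lookup-⁅x⁆ u)
  ... | inj₂ (inj₂ refl) = colon-intro I a I-up ⁅ u ⁆ (⁅ a ⁆ ∪ ⁅ u ⁆) (pair-swap⊆ a u) ab∈I

  remove-b∈I : ∀ σ → I σ ≡ true → Vec.lookup σ a ≡ false → Vec.lookup σ b ≡ true → I (σ - b) ≡ true
  remove-b∈I σ σ∈I a∉σ b∈σ =
    trans (sym (cone-off-a (σ - b) (trans (lookup-remove-other σ a b a≢b) a∉σ) (lookup-remove-self σ b)))
          (trans (cong I (insert-remove σ b b∈σ)) σ∈I)

  module _ {f : Chain n} (f-sup : Supported I′ f) where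

    above-suc-k : SupportedAbove π (ℕ.suc k) f
    above-suc-k σ u u∈σ u≤ = f-sup σ (I′-up ⁅ u ⁆ σ (⁅x⁆⊆ σ u u∈σ) (below-suc-suc-k∈I′ u (ℕ.s≤s u≤)))

    ∂-mulVarDiff : ∀ σ → ∂ π (mulVarDiff a b f) σ ≡ - mulVarDiff a b (∂ π f) σ
    ∂-mulVarDiff σ = begin
      ∂ π (mulVarDiff a b f) σ
        ≡⟨ ∂-+ π (mulVar a f) (λ ρ → - mulVar b f ρ) σ ⟩
      ∂ π (mulVar a f) σ ℤ.+ ∂ π (λ ρ → - mulVar b f ρ) σ
        ≡⟨ cong (ℤ._+_ (∂ π (mulVar a f) σ)) (∂-neg π (mulVar b f) σ) ⟩
      ∂ π (mulVar a f) σ ℤ.- ∂ π (mulVar b f) σ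
        ≡⟨ cong₂ ℤ._-_ (∂-mulVar π a f above-a σ) (∂-mulVar π b f above-b σ) ⟩
      (f σ ℤ.- mulVar a (∂ π f) σ) ℤ.- (f σ ℤ.- mulVar b (∂ π f) σ)
        ≡⟨ solve 3 (λ F A B → (F :- A) :- (F :- B) := :- (A :- B)) refl
                 (f σ) (mulVar a (∂ π f) σ) (mulVar b (∂ π f) σ) ⟩
      - mulVarDiff a b (∂ π f) σ
        ∎
      where
      open ≡-Reasoning
      above-a : SupportedAbove π (rank π a) f
      above-a = SupportedAbove-mono π f (ℕ.≤-trans (ℕ.≤-reflexive rank-a) (ℕ.n≤1+n k)) above-suc-k
      above-b : SupportedAbove π (rank π b) f
      above-b = SupportedAbove-mono π f (ℕ.≤-reflexive rank-b) above-suc-k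

    mulVarDiff-supported : Supported I (mulVarDiff a b f)
    mulVarDiff-supported σ σ∈I = cong₂ ℤ._-_ a-term b-term
      where
      a-term : mulVar a f σ ≡ 0ℤ
      a-term with Vec.lookup σ a in a∈σ
      ... | false = refl
      ... | true  =
        f-sup (σ - a) (trans (cong₂ _∨_ (lookup-remove-self σ a) (cong I (insert-remove σ a a∈σ))) σ∈I)
      b-term : mulVar b f σ ≡ 0ℤ
      b-term with Vec.lookup σ b in b∈σ
      ... | false = refl
      ... | true with Vec.lookup σ a in a∈?σ
      ...   | true  =
        f-sup (σ - b) (cong (_∨ I ((σ - b) ∪ ⁅ a ⁆)) (trans (lookup-remove-other σ a b a≢b) a∈?σ))
      ...   | false = f-sup (σ - b) (colon-⊇ I a I-up (σ - b) (remove-b∈I σ σ∈I a∈?σ b∈σ))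

  restrict : Chain n → Chain n
  restrict f τ = if Vec.lookup τ a ∨ Vec.lookup τ b then 0ℤ else f τ

  restrict-a : (f : Chain n) (τ : Subset n) → Vec.lookup τ a ≡ true → restrict f τ ≡ 0ℤ
  restrict-a f τ a∈τ rewrite a∈τ = refl

  restrict-b : (f : Chain n) (τ : Subset n) → Vec.lookup τ b ≡ true → restrict f τ ≡ 0ℤ
  restrict-b f τ b∈τ rewrite b∈τ | ∨-zeroʳ (Vec.lookup τ a) = refl

  restrict-off : (f : Chain n) (τ : Subset n) → Vec.lookup τ a ≡ false → Vec.lookup τ b ≡ false →
                 restrict f τ ≡ f τ
  restrict-off f τ a∉τ b∉τ rewrite a∉τ | b∉τ = refl

  restrict-above : (f : Chain n) → (∀ σ u → Vec.lookup σ u ≡ true → rank π u ℕ.< k → f σ ≡ 0ℤ) →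
                   SupportedAbove π (ℕ.suc k) (restrict f)
  restrict-above f f≡0 σ u u∈σ u≤ with rank≤suc-k u u≤
  ... | inj₂ (inj₁ refl) = restrict-a f σ u∈σ
  ... | inj₂ (inj₂ refl) = restrict-b f σ u∈σ
  ... | inj₁ u<k with Vec.lookup σ a ∨ Vec.lookup σ b
  ...   | true  = refl
  ...   | false = f≡0 σ u u∈σ u<k

  -- c = w + a·u + b·v, where w is c on faces avoiding a and b, and u, v are the links of a, b in c.
  module Generation (c : Chain n) (c-sup : Supported I c) (c-cyc : ∀ σ → ∂ π c σ ≡ 0ℤ) where

    link : Fin n → Chain n
    link x τ = c (τ ∪ ⁅ x ⁆)

    w u v : Chain n
    w = restrict c
    u = restrict (link a)
    v = restrict (link b)

    c-below-k : ∀ σ x → Vec.lookup σ x ≡ true → rank π x ℕ.< k → c σ ≡ 0ℤ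
    c-below-k σ x x∈σ x<k = c-sup σ (below-k-faces∈I σ x x∈σ x<k)

    link-below-k : ∀ y σ x → Vec.lookup σ x ≡ true → rank π x ℕ.< k → c (σ ∪ ⁅ y ⁆) ≡ 0ℤ
    link-below-k y σ x x∈σ = c-below-k (σ ∪ ⁅ y ⁆) x (lookup-insert⁺ σ x y x∈σ)

    w-above : SupportedAbove π (rank π b) w
    w-above = subst (λ j → SupportedAbove π j w) (sym rank-b) (restrict-above c c-below-k)

    u-above : SupportedAbove π (rank π a) u
    u-above = SupportedAbove-mono π u (ℕ.≤-trans (ℕ.≤-reflexive rank-a) (ℕ.n≤1+n k))
                (restrict-above (link a) (link-below-k a))

    v-above : SupportedAbove π (rank π b) v
    v-above = subst (λ j → SupportedAbove π j v) (sym rank-b) (restrict-above (link b) (link-below-k b))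

    a-part : ∀ σ → Vec.lookup σ a ≡ true → mulVar a u σ ≡ (if Vec.lookup σ b then 0ℤ else c σ)
    a-part σ a∈σ rewrite a∈σ | lookup-remove-self σ a | lookup-remove-other σ b a (a≢b ∘ sym)
                       | insert-remove σ a a∈σ = refl

    b-part : ∀ σ → Vec.lookup σ b ≡ true → mulVar b v σ ≡ (if Vec.lookup σ a then 0ℤ else c σ)
    b-part σ b∈σ rewrite b∈σ | lookup-remove-self σ b | lookup-remove-other σ a b a≢b
                       | insert-remove σ b b∈σ | ∨-identityʳ (Vec.lookup σ a) = refl

    private
      assemble : ∀ {σ p q r} → w σ ≡ p → mulVar a u σ ≡ q → mulVar b v σ ≡ r → c σ ≡ p ℤ.+ (q ℤ.+ r) →
                 c σ ≡ w σ ℤ.+ (mulVar a u σ ℤ.+ mulVar b v σ)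
      assemble wp uq vr c≡ = trans c≡ (sym (cong₂ ℤ._+_ wp (cong₂ ℤ._+_ uq vr)))

    decomposition : ∀ σ → c σ ≡ w σ ℤ.+ (mulVar a u σ ℤ.+ mulVar b v σ)
    decomposition σ = by-cases (Vec.lookup σ a) (Vec.lookup σ b) refl refl
      where
      by-cases : ∀ α β → Vec.lookup σ a ≡ α → Vec.lookup σ b ≡ β →
                 c σ ≡ w σ ℤ.+ (mulVar a u σ ℤ.+ mulVar b v σ)
      by-cases true  true  a∈σ b∈σ =
        assemble (restrict-a c σ a∈σ) (trans (a-part σ a∈σ) (cong (if_then 0ℤ else c σ) b∈σ))
                 (trans (b-part σ b∈σ) (cong (if_then 0ℤ else c σ) a∈σ)) (c-sup σ (ab-faces∈I σ a∈σ b∈σ))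
      by-cases true  false a∈σ b∉σ =
        assemble (restrict-a c σ a∈σ) (trans (a-part σ a∈σ) (cong (if_then 0ℤ else c σ) b∉σ))
                 (mulVar-outside b v σ b∉σ) (sym (trans (ℤ.+-identityˡ _) (ℤ.+-identityʳ (c σ))))
      by-cases false true  a∉σ b∈σ =
        assemble (restrict-b c σ b∈σ) (mulVar-outside a u σ a∉σ)
                 (trans (b-part σ b∈σ) (cong (if_then 0ℤ else c σ) a∉σ))
                 (sym (trans (ℤ.+-identityˡ _) (ℤ.+-identityˡ (c σ))))
      by-cases false false a∉σ b∉σ =
        assemble (restrict-off c σ a∉σ b∉σ) (mulVar-outside a u σ a∉σ) (mulVar-outside b v σ b∉σ)
                 (sym (ℤ.+-identityʳ (c σ)))

    ∂-decomposition : ∀ σ → ∂ π c σ ≡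
      ∂ π w σ ℤ.+ ((u σ ℤ.- mulVar a (∂ π u) σ) ℤ.+ (v σ ℤ.- mulVar b (∂ π v) σ))
    ∂-decomposition σ = begin
      ∂ π c σ
        ≡⟨ ∂-cong π decomposition σ ⟩
      ∂ π (λ ρ → w ρ ℤ.+ (mulVar a u ρ ℤ.+ mulVar b v ρ)) σ
        ≡⟨ ∂-+ π w (λ ρ → mulVar a u ρ ℤ.+ mulVar b v ρ) σ ⟩
      ∂ π w σ ℤ.+ ∂ π (λ ρ → mulVar a u ρ ℤ.+ mulVar b v ρ) σ
        ≡⟨ cong (ℤ._+_ (∂ π w σ)) (∂-+ π (mulVar a u) (mulVar b v) σ) ⟩
      ∂ π w σ ℤ.+ (∂ π (mulVar a u) σ ℤ.+ ∂ π (mulVar b v) σ)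
        ≡⟨ cong (ℤ._+_ (∂ π w σ)) (cong₂ ℤ._+_ (∂-mulVar π a u u-above σ) (∂-mulVar π b v v-above σ)) ⟩
      ∂ π w σ ℤ.+ ((u σ ℤ.- mulVar a (∂ π u) σ) ℤ.+ (v σ ℤ.- mulVar b (∂ π v) σ)) ∎
      where open ≡-Reasoning

    links-cancel : ∀ τ → Vec.lookup τ a ≡ false → Vec.lookup τ b ≡ false → ∂ π w τ ℤ.+ (u τ ℤ.+ v τ) ≡ 0ℤ
    links-cancel τ a∉τ b∉τ = begin
      ∂ π w τ ℤ.+ (u τ ℤ.+ v τ)
        ≡⟨ cong (ℤ._+_ (∂ π w τ)) (sym (cong₂ ℤ._+_ (ℤ.+-identityʳ (u τ)) (ℤ.+-identityʳ (v τ)))) ⟩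
      ∂ π w τ ℤ.+ ((u τ ℤ.- 0ℤ) ℤ.+ (v τ ℤ.- 0ℤ))
        ≡⟨ cong₂ (λ p q → ∂ π w τ ℤ.+ ((u τ ℤ.- p) ℤ.+ (v τ ℤ.- q)))
                 (mulVar-outside a (∂ π u) τ a∉τ) (mulVar-outside b (∂ π v) τ b∉τ) ⟨
      ∂ π w τ ℤ.+ ((u τ ℤ.- mulVar a (∂ π u) τ) ℤ.+ (v τ ℤ.- mulVar b (∂ π v) τ))
        ≡⟨ ∂-decomposition τ ⟨
      ∂ π c τ ≡⟨ c-cyc τ ⟩
      0ℤ      ∎
      where open ≡-Reasoning

    u-cycle : ∀ τ → ∂ π u τ ≡ 0ℤ
    u-cycle τ = by-cases (Vec.lookup τ a) (Vec.lookup τ b) refl refl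
      where
      by-cases : ∀ α β → Vec.lookup τ a ≡ α → Vec.lookup τ b ≡ β → ∂ π u τ ≡ 0ℤ
      by-cases true  _     a∈τ _   = ∂-vanishes π a u (restrict-a (link a)) τ a∈τ
      by-cases false true  _   b∈τ = ∂-vanishes π b u (restrict-b (link a)) τ b∈τ
      by-cases false false a∉τ b∉τ = begin
        ∂ π u τ
          ≡⟨ solve 1 (λ X → X := :- (con 0ℤ :+ ((con 0ℤ :- X) :+ (con 0ℤ :- con 0ℤ)))) refl (∂ π u τ) ⟩
        - (0ℤ ℤ.+ ((0ℤ ℤ.- ∂ π u τ) ℤ.+ (0ℤ ℤ.- 0ℤ)))
          ≡⟨ cong -_ values-at-τa ⟨
        - (∂ π w τa ℤ.+ ((u τa ℤ.- mulVar a (∂ π u) τa) ℤ.+ (v τa ℤ.- mulVar b (∂ π v) τa)))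
          ≡⟨ cong -_ (trans (sym (∂-decomposition τa)) (c-cyc τa)) ⟩
        - 0ℤ ∎
        where
        open ≡-Reasoning
        τa : Subset n
        τa = τ ∪ ⁅ a ⁆
        a∈τa : Vec.lookup τa a ≡ true
        a∈τa = lookup-insert-self τ a
        b∉τa : Vec.lookup τa b ≡ false
        b∉τa = trans (lookup-insert-other τ b a (a≢b ∘ sym)) b∉τ
        values-at-τa : ∂ π w τa ℤ.+ ((u τa ℤ.- mulVar a (∂ π u) τa) ℤ.+ (v τa ℤ.- mulVar b (∂ π v) τa))
                       ≡ 0ℤ ℤ.+ ((0ℤ ℤ.- ∂ π u τ) ℤ.+ (0ℤ ℤ.- 0ℤ))
        values-at-τa = cong₂ ℤ._+_ (∂-vanishes π a w (restrict-a c) τa a∈τa)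
          (cong₂ ℤ._+_ (cong₂ ℤ._-_ (restrict-a (link a) τa a∈τa) (mulVar-insert a (∂ π u) τ a∉τ))
                       (cong₂ ℤ._-_ (restrict-a (link b) τa a∈τa) (mulVar-outside b (∂ π v) τa b∉τa)))

    vanishes-off-b : ∀ τ → Vec.lookup τ b ≡ false → ∂ π w τ ℤ.+ (u τ ℤ.+ v τ) ≡ 0ℤ
    vanishes-off-b τ b∉τ = by-cases (Vec.lookup τ a) refl
      where
      by-cases : ∀ α → Vec.lookup τ a ≡ α → ∂ π w τ ℤ.+ (u τ ℤ.+ v τ) ≡ 0ℤ
      by-cases true  a∈τ = cong₂ ℤ._+_ (∂-vanishes π a w (restrict-a c) τ a∈τ)
                                       (cong₂ ℤ._+_ (restrict-a (link a) τ a∈τ) (restrict-a (link b) τ a∈τ))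
      by-cases false a∉τ = links-cancel τ a∉τ b∉τ

    c-formula : ∀ σ → c σ ≡ ∂ π (mulVar b w) σ ℤ.+ mulVarDiff a b u σ
    c-formula σ = begin
      c σ                                            ≡⟨ decomposition σ ⟩
      w σ ℤ.+ (au ℤ.+ bv)
        ≡⟨ solve 5 (λ W AU BV B∂W BU → W :+ (AU :+ BV) := ((W :- B∂W) :+ (AU :- BU)) :+ (B∂W :+ (BU :+ BV)))
                 refl (w σ) au bv (mulVar b (∂ π w) σ) (mulVar b u σ) ⟩
      (w σ ℤ.- mulVar b (∂ π w) σ) ℤ.+ mulVarDiff a b u σ ℤ.+ (mulVar b (∂ π w) σ ℤ.+ (mulVar b u σ ℤ.+ bv))
        ≡⟨ cong (ℤ._+_ ((w σ ℤ.- mulVar b (∂ π w) σ) ℤ.+ mulVarDiff a b u σ)) b-multiple-vanishes ⟩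
      (w σ ℤ.- mulVar b (∂ π w) σ) ℤ.+ mulVarDiff a b u σ ℤ.+ 0ℤ
        ≡⟨ ℤ.+-identityʳ _ ⟩
      (w σ ℤ.- mulVar b (∂ π w) σ) ℤ.+ mulVarDiff a b u σ
        ≡⟨ cong (ℤ._+ mulVarDiff a b u σ) (∂-mulVar π b w w-above σ) ⟨
      ∂ π (mulVar b w) σ ℤ.+ mulVarDiff a b u σ      ∎
      where
      open ≡-Reasoning
      au bv : ℤ
      au = mulVar a u σ
      bv = mulVar b v σ
      b-multiple-vanishes : mulVar b (∂ π w) σ ℤ.+ (mulVar b u σ ℤ.+ bv) ≡ 0ℤ
      b-multiple-vanishes = begin
        mulVar b (∂ π w) σ ℤ.+ (mulVar b u σ ℤ.+ bv)
          ≡⟨ cong (ℤ._+_ (mulVar b (∂ π w) σ)) (mulVar-+ b u v σ) ⟨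
        mulVar b (∂ π w) σ ℤ.+ mulVar b (λ ρ → u ρ ℤ.+ v ρ) σ
          ≡⟨ mulVar-+ b (∂ π w) (λ ρ → u ρ ℤ.+ v ρ) σ ⟨
        mulVar b (λ ρ → ∂ π w ρ ℤ.+ (u ρ ℤ.+ v ρ)) σ
          ≡⟨ mulVar-vanishes b _ vanishes-off-b σ ⟩
        0ℤ ∎

    bw-sup : Supported I (mulVar b w)
    bw-sup σ σ∈I = by-cases (Vec.lookup σ b) (Vec.lookup σ a) refl refl
      where
      by-cases : ∀ β α → Vec.lookup σ b ≡ β → Vec.lookup σ a ≡ α → mulVar b w σ ≡ 0ℤ
      by-cases false _     b∉σ _   = mulVar-outside b w σ b∉σ
      by-cases true  true  b∈σ a∈σ =
        trans (mulVar-inside b w σ b∈σ) (restrict-a c (σ - b) (trans (lookup-remove-other σ a b a≢b) a∈σ))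
      by-cases true  false b∈σ a∉σ =
        trans (mulVar-inside b w σ b∈σ)
          (trans (restrict-off c (σ - b) (trans (lookup-remove-other σ a b a≢b) a∉σ) (lookup-remove-self σ b))
                 (c-sup (σ - b) (remove-b∈I σ σ∈I a∉σ b∈σ)))

    u-sup : Supported I′ u
    u-sup τ τ∈I′ with Vec.lookup τ a | Vec.lookup τ b
    ... | true  | _     = refl
    ... | false | true  = refl
    ... | false | false = c-sup (τ ∪ ⁅ a ⁆) τ∈I′

    homologous : (z′ : Chain n) → CyclesAreMultiplesOf I′ π z′ →
                 HomologousToMultiple I π c (mulVarDiff a b z′)
    homologous z′ z′-gen with z′-gen u u-sup (λ τ → trans (boundary≗∂ I′ π u I′-up u-sup τ) (u-cycle τ))
    ... | K , d′ , d′-sup , u≡ = K , d , d-sup , expansion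
      where
      open ≡-Reasoning
      d : Chain n
      d σ = mulVar b w σ ℤ.- mulVarDiff a b d′ σ
      d-sup : Supported I d
      d-sup σ σ∈I = cong₂ ℤ._-_ (bw-sup σ σ∈I) (mulVarDiff-supported d′-sup σ σ∈I)
      u≗ : ∀ τ → u τ ≡ K ℤ.* z′ τ ℤ.+ ∂ π d′ τ
      u≗ τ = trans (u≡ τ) (cong (ℤ._+_ (K ℤ.* z′ τ)) (boundary≗∂ I′ π d′ I′-up d′-sup τ))
      expansion : ∀ σ → c σ ≡ K ℤ.* mulVarDiff a b z′ σ ℤ.+ boundary I π d σ
      expansion σ = begin
        c σ                                                     ≡⟨ c-formula σ ⟩
        ∂ π (mulVar b w) σ ℤ.+ mulVarDiff a b u σ
          ≡⟨ cong (ℤ._+_ (∂ π (mulVar b w) σ))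
                  (trans (mulVarDiff-cong a b u≗ σ) (mulVarDiff-linear a b K z′ (∂ π d′) σ)) ⟩
        ∂ π (mulVar b w) σ ℤ.+ (K ℤ.* Z ℤ.+ mulVarDiff a b (∂ π d′) σ)
          ≡⟨ solve 4 (λ BW k Z′ D′ → BW :+ (k :* Z′ :+ D′) := k :* Z′ :+ (BW :- :- D′))
                   refl (∂ π (mulVar b w) σ) K Z (mulVarDiff a b (∂ π d′) σ) ⟩
        K ℤ.* Z ℤ.+ (∂ π (mulVar b w) σ ℤ.- - mulVarDiff a b (∂ π d′) σ)
          ≡⟨ cong (λ t → K ℤ.* Z ℤ.+ (∂ π (mulVar b w) σ ℤ.- t)) (∂-mulVarDiff d′-sup σ) ⟨
        K ℤ.* Z ℤ.+ (∂ π (mulVar b w) σ ℤ.- ∂ π (mulVarDiff a b d′) σ)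
          ≡⟨ cong (ℤ._+_ (K ℤ.* Z)) ∂d ⟨
        K ℤ.* Z ℤ.+ ∂ π d σ
          ≡⟨ cong (ℤ._+_ (K ℤ.* Z)) (boundary≗∂ I π d I-up d-sup σ) ⟨
        K ℤ.* Z ℤ.+ boundary I π d σ                            ∎
        where
        Z : ℤ
        Z = mulVarDiff a b z′ σ
        ∂d : ∂ π d σ ≡ ∂ π (mulVar b w) σ ℤ.- ∂ π (mulVarDiff a b d′) σ
        ∂d = trans (∂-+ π (mulVar b w) (λ ρ → - mulVarDiff a b d′ ρ) σ)
                   (cong (ℤ._+_ (∂ π (mulVar b w) σ)) (∂-neg π (mulVarDiff a b d′) σ))

  step : (z′ : Chain n) → HomologyGeneratedBy I′ π z′ → HomologyGeneratedBy I π (mulVarDiff a b z′)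
  step z′ (z′-sup , z′-cyc , z′-gen) = mulVarDiff-supported z′-sup , cycle , generates
    where
    open ≡-Reasoning

    cycle : ∀ σ → boundary I π (mulVarDiff a b z′) σ ≡ 0ℤ
    cycle σ = begin
      boundary I π (mulVarDiff a b z′) σ ≡⟨ boundary≗∂ I π _ I-up (mulVarDiff-supported z′-sup) σ ⟩
      ∂ π (mulVarDiff a b z′) σ          ≡⟨ ∂-mulVarDiff z′-sup σ ⟩
      - mulVarDiff a b (∂ π z′) σ        ≡⟨ cong -_ (cong₂ ℤ._-_ (mulVar-vanishes a _ (λ τ _ → ∂z′≡0 τ) σ)
                                                              (mulVar-vanishes b _ (λ τ _ → ∂z′≡0 τ) σ)) ⟩
      0ℤ                                 ∎
      where
      ∂z′≡0 : ∀ ρ → ∂ π z′ ρ ≡ 0ℤ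
      ∂z′≡0 ρ = trans (sym (boundary≗∂ I′ π z′ I′-up z′-sup ρ)) (z′-cyc ρ)

    generates : CyclesAreMultiplesOf I π (mulVarDiff a b z′)
    generates c c-sup c-bcyc =
      Generation.homologous c c-sup (λ σ → trans (sym (boundary≗∂ I π c I-up c-sup σ)) (c-bcyc σ)) z′ z′-gen

-- Homology along a resolution

eqSub-sound : (σ τ : Subset n) → eqSub σ τ ≡ true → σ ≡ τ
eqSub-sound []          []          _  = refl
eqSub-sound (true ∷ σ)  (true ∷ τ)  eq = cong (true ∷_) (eqSub-sound σ τ eq)
eqSub-sound (false ∷ σ) (false ∷ τ) eq = cong (false ∷_) (eqSub-sound σ τ eq)

eqSub-∅-false : (σ : Subset n) → eqSub σ ∅ ≡ false → ∃ λ u → Vec.lookup σ u ≡ true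
eqSub-∅-false (true ∷ σ)  _  = zero , refl
eqSub-∅-false (false ∷ σ) eq = let u , u∈σ = eqSub-∅-false σ eq in suc u , u∈σ

emptyFace : Chain n
emptyFace σ = if eqSub σ ∅ then 1ℤ else 0ℤ

emptyFace-nonempty : (σ : Subset n) (u : Fin n) → Vec.lookup σ u ≡ true → emptyFace σ ≡ 0ℤ
emptyFace-nonempty σ u u∈σ with eqSub σ ∅ in σ≡∅
... | false = refl
... | true  with () ← trans (sym u∈σ) (trans (cong (λ τ → Vec.lookup τ u) (eqSub-sound σ ∅ σ≡∅)) (lookup-∅ u))

emptyFace-generates : (π : Permutation′ n) (I : SqIdeal n) → UpClosed I → I ∅ ≡ false →
                      (∀ v → I ⁅ v ⁆ ≡ true) → HomologyGeneratedBy I π emptyFace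
emptyFace-generates {n} π I I-up ∅∉I vars∈I = supported , cycle , generates
  where
  supported : Supported I emptyFace
  supported σ σ∈I with eqSub σ ∅ in σ≡∅
  ... | false = refl
  ... | true  with () ← trans (sym σ∈I) (trans (cong I (eqSub-sound σ ∅ σ≡∅)) ∅∉I)
  cycle : ∀ σ → boundary I π emptyFace σ ≡ 0ℤ
  cycle σ = trans (boundary≗∂ I π emptyFace I-up supported σ)
                  (∂-zero π emptyFace σ (λ v _ → emptyFace-nonempty (σ ∪ ⁅ v ⁆) v (lookup-insert-self σ v)))
  zero-chain-cycle : ∀ σ → boundary I π (λ _ → 0ℤ) σ ≡ 0ℤ
  zero-chain-cycle σ = trans (boundary≗∂ I π _ I-up (λ _ _ → refl) σ) (∂-zero π _ σ (λ _ _ → refl))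
  generates : CyclesAreMultiplesOf I π emptyFace
  generates c c-sup _ = c ∅ , (λ _ → 0ℤ) , (λ _ _ → refl) , expansion
    where
    expansion : ∀ σ → c σ ≡ c ∅ ℤ.* emptyFace σ ℤ.+ boundary I π (λ _ → 0ℤ) σ
    expansion σ rewrite zero-chain-cycle σ | ℤ.+-identityʳ (c ∅ ℤ.* emptyFace σ) with eqSub σ ∅ in σ≡?∅
    ... | true  rewrite eqSub-sound σ ∅ σ≡?∅ = sym (ℤ.*-identityʳ (c ∅))
    ... | false = trans (c-sup σ (I-up ⁅ u ⁆ σ (⁅x⁆⊆ σ u u∈σ) (vars∈I u))) (sym (ℤ.*-zeroʳ (c ∅)))
      where
      u : Fin n
      u = proj₁ (eqSub-∅-false σ σ≡?∅)
      u∈σ : Vec.lookup σ u ≡ true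
      u∈σ = proj₂ (eqSub-∅-false σ σ≡?∅)

productChain : (r : ℕ) → (Fin r → Fin n) → (Fin r → Fin n) → Chain n
productChain ℕ.zero    a b = emptyFace
productChain (ℕ.suc r) a b = mulVarDiff (a zero) (b zero) (productChain r (a ∘ suc) (b ∘ suc))

RanksInterleaved : Permutation′ n → ℕ → (r : ℕ) → (Fin r → Fin n) → (Fin r → Fin n) → Set
RanksInterleaved π k r a b = ∀ i → rank π (a i) ≡ k + 2 * toℕ i × rank π (b i) ≡ k + 2 * toℕ i + 1

RanksInterleaved-tail : (π : Permutation′ n) (k r : ℕ) (a b : Fin (ℕ.suc r) → Fin n) →
                        RanksInterleaved π k (ℕ.suc r) a b → RanksInterleaved π (2 + k) r (a ∘ suc) (b ∘ suc)
RanksInterleaved-tail π k r a b ranks i =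
  trans (proj₁ (ranks (suc i))) (shift (toℕ i)) , trans (proj₂ (ranks (suc i))) (cong (_+ 1) (shift (toℕ i)))
  where
  shift : ∀ j → k + 2 * ℕ.suc j ≡ 2 + k + 2 * j
  shift j = begin
    k + 2 * ℕ.suc j   ≡⟨ cong (k +_) (ℕ.*-suc 2 j) ⟩
    k + (2 + 2 * j)   ≡⟨ ℕ.+-assoc k 2 (2 * j) ⟨
    k + 2 + 2 * j     ≡⟨ cong (_+ 2 * j) (ℕ.+-comm k 2) ⟩
    2 + k + 2 * j     ∎
    where open ≡-Reasoning

resolution-homology : (π : Permutation′ n) (I : SqIdeal n) (A : List (Fin n)) (b : Fin (length A) → Fin n)
  (k : ℕ) →
  UpClosed I → GeneratedInDegree≤2 I → I ∅ ≡ false → (∀ u → rank π u ℕ.< k → I ⁅ u ⁆ ≡ true) →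
  (∀ v → colonProd I A ⁅ v ⁆ ≡ true) → (∀ i → ¬ (lookup A i ∈I stage I A i)) →
  (∀ i → Dominates (stage I A i) (lookup A i) (b i)) → RanksInterleaved π k (length A) (lookup A) b →
  HomologyGeneratedBy I π (productChain (length A) (lookup A) b)
resolution-homology π I [] b k I-up I-gen ∅∉I _ vars∈I _ _ _ = emptyFace-generates π I I-up ∅∉I vars∈I
resolution-homology π I (a ∷ A) b k I-up I-gen ∅∉I below-k∈I vars∈I a∉ dom ranks =
  S.step _ (resolution-homology π (colon I a) A (b ∘ suc) (2 + k)
    (colon-upClosed I a I-up) (colon-degree≤2 I a I-up I-gen) (trans (colon-∅ I a I-up) (¬-not (a∉ zero)))
    S.below-suc-suc-k∈I′ vars∈I (a∉ ∘ suc) (dom ∘ suc)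
    (RanksInterleaved-tail π k (length A) (lookup (a ∷ A)) b ranks))
  where
  rank-a : rank π a ≡ k
  rank-a = trans (proj₁ (ranks zero)) (ℕ.+-identityʳ k)
  rank-b : rank π (b zero) ≡ ℕ.suc k
  rank-b = trans (proj₂ (ranks zero)) (trans (cong (_+ 1) (ℕ.+-identityʳ k)) (ℕ.+-comm k 1))
  module S = Step π I I-up a (b zero) k rank-a rank-b below-k∈I
               (domination-facts I I-up I-gen ∅∉I a (b zero) (dom zero))

-- Edge ideals of forests and maximal resolutions

anyFin-tabulate : ∀ {m} (g : Fin m → Fin n) (p : Fin n → Bool) →
                  foldr (λ v s → p v ∨ s) false (List.tabulate g) ≡ anyFin (p ∘ g)
anyFin-tabulate {m = ℕ.zero}  g p = refl
anyFin-tabulate {m = ℕ.suc m} g p =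
  cong (p (g zero) ∨_) (trans (anyFin-tabulate (g ∘ suc) p) (sym (anyFin-tabulate suc (p ∘ g))))

anyFin⁺ : (p : Fin n → Bool) (v : Fin n) → p v ≡ true → anyFin p ≡ true
anyFin⁺ p zero    pv rewrite pv = refl
anyFin⁺ p (suc v) pv with p zero
... | true  = refl
... | false = trans (anyFin-tabulate suc p) (anyFin⁺ (p ∘ suc) v pv)

anyFin⁻ : (p : Fin n → Bool) → anyFin p ≡ true → ∃ λ v → p v ≡ true
anyFin⁻ {ℕ.suc n} p any≡ with p zero in p0
... | true  = zero , p0
... | false = let v , pv = anyFin⁻ (p ∘ suc) (trans (sym (anyFin-tabulate suc p)) any≡) in suc v , pv

module _ (F : SimpleGraph n) where

  edgeIdeal⁻ : ∀ σ → edgeIdeal F σ ≡ true →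
               ∃₂ λ u v → Vec.lookup σ u ≡ true × Vec.lookup σ v ≡ true × adj F u v ≡ true
  edgeIdeal⁻ σ σ∈ with anyFin⁻ _ σ∈
  ... | u , u∈ with anyFin⁻ _ u∈
  ...   | v , uv∈ = u , v , ∧³-true uv∈
    where
    ∧³-true : ∀ {p q r} → (p ∧ q ∧ r) ≡ true → p ≡ true × q ≡ true × r ≡ true
    ∧³-true {true} {true} {true} _ = refl , refl , refl

  edgeIdeal⁺ : ∀ σ u v → Vec.lookup σ u ≡ true → Vec.lookup σ v ≡ true → adj F u v ≡ true →
               edgeIdeal F σ ≡ true
  edgeIdeal⁺ σ u v u∈σ v∈σ u~v =
    anyFin⁺ _ u (anyFin⁺ _ v (trans (cong₂ (λ p q → p ∧ q ∧ adj F u v) u∈σ v∈σ) u~v))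

  edge∈edgeIdeal : ∀ u v → adj F u v ≡ true → edgeIdeal F (⁅ u ⁆ ∪ ⁅ v ⁆) ≡ true
  edge∈edgeIdeal u v = edgeIdeal⁺ (⁅ u ⁆ ∪ ⁅ v ⁆) u v (∈pairˡ u v) (∈pairʳ u v)

  adj-irrefl : ∀ u v → adj F u v ≡ true → u ≢ v
  adj-irrefl u v u~v refl with () ← trans (sym u~v) (irrefl F u)

  adj-sym : ∀ {u v} → adj F u v ≡ true → adj F v u ≡ true
  adj-sym {u} {v} u~v = trans (SimpleGraph.sym F v u) u~v

  edgeIdeal-upClosed : UpClosed (edgeIdeal F)
  edgeIdeal-upClosed σ τ σ⊆τ σ∈ with edgeIdeal⁻ σ σ∈
  ... | u , v , u∈σ , v∈σ , u~v = edgeIdeal⁺ τ u v (σ⊆τ u u∈σ) (σ⊆τ v v∈σ) u~v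

  edgeIdeal-degree≤2 : GeneratedInDegree≤2 (edgeIdeal F)
  edgeIdeal-degree≤2 σ σ∈ with edgeIdeal⁻ σ σ∈
  ... | u , v , u∈σ , v∈σ , u~v = inj₂ (u , v , u∈σ , v∈σ , edge∈edgeIdeal u v u~v)

  edgeIdeal-∅ : edgeIdeal F ∅ ≡ false
  edgeIdeal-∅ = ¬-not λ ∅∈ → let u , _ , u∈∅ , _ = edgeIdeal⁻ ∅ ∅∈ in absurdᵇ u∈∅ (lookup-∅ u)

  pair∈edgeIdeal⇒edge : ∀ u v → edgeIdeal F (⁅ u ⁆ ∪ ⁅ v ⁆) ≡ true → adj F u v ≡ true
  pair∈edgeIdeal⇒edge u v uv∈ with edgeIdeal⁻ (⁅ u ⁆ ∪ ⁅ v ⁆) uv∈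
  ... | p , q , p∈ , q∈ , p~q with lookup-pair⁻ u v p p∈ | lookup-pair⁻ u v q q∈
  ...   | inj₁ refl | inj₁ refl = ⊥-elim (adj-irrefl p p p~q refl)
  ...   | inj₁ refl | inj₂ refl = p~q
  ...   | inj₂ refl | inj₁ refl = adj-sym p~q
  ...   | inj₂ refl | inj₂ refl = ⊥-elim (adj-irrefl p p p~q refl)

record EdgeIdealPlusVariables (F : SimpleGraph n) (J : SqIdeal n) : Set where
  field
    upClosed        : UpClosed J
    degree≤2        : GeneratedInDegree≤2 J
    edges∈          : ∀ u v → adj F u v ≡ true → J (⁅ u ⁆ ∪ ⁅ v ⁆) ≡ true
    pairs-are-edges : ∀ u v → J ⁅ u ⁆ ≡ false → J ⁅ v ⁆ ≡ false → J (⁅ u ⁆ ∪ ⁅ v ⁆) ≡ true → adj F u v ≡ true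

edgeIdeal-plusVariables : (F : SimpleGraph n) → EdgeIdealPlusVariables F (edgeIdeal F)
edgeIdeal-plusVariables F = record
  { upClosed        = edgeIdeal-upClosed F
  ; degree≤2        = edgeIdeal-degree≤2 F
  ; edges∈          = edge∈edgeIdeal F
  ; pairs-are-edges = λ u v _ _ → pair∈edgeIdeal⇒edge F u v
  }

pair-in-triple : (u v x p q : Fin n) → Vec.lookup ((⁅ u ⁆ ∪ ⁅ v ⁆) ∪ ⁅ x ⁆) p ≡ true →
                 Vec.lookup ((⁅ u ⁆ ∪ ⁅ v ⁆) ∪ ⁅ x ⁆) q ≡ true →
                 ⁅ p ⁆ ∪ ⁅ q ⁆ ⊆ ⁅ u ⁆ ∪ ⁅ x ⁆ ⊎ ⁅ p ⁆ ∪ ⁅ q ⁆ ⊆ ⁅ v ⁆ ∪ ⁅ x ⁆ ⊎ ⁅ p ⁆ ∪ ⁅ q ⁆ ⊆ ⁅ u ⁆ ∪ ⁅ v ⁆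
pair-in-triple u v x p q p∈ q∈ with triple⁻ p p∈ | triple⁻ q q∈
  where
  triple⁻ : ∀ w → Vec.lookup ((⁅ u ⁆ ∪ ⁅ v ⁆) ∪ ⁅ x ⁆) w ≡ true →
            Vec.lookup (⁅ u ⁆ ∪ ⁅ x ⁆) w ≡ true × w ≡ u ⊎ Vec.lookup (⁅ v ⁆ ∪ ⁅ x ⁆) w ≡ true × w ≡ v ⊎
            Vec.lookup (⁅ u ⁆ ∪ ⁅ x ⁆) w ≡ true × Vec.lookup (⁅ v ⁆ ∪ ⁅ x ⁆) w ≡ true
  triple⁻ w w∈ with lookup-insert⁻ (⁅ u ⁆ ∪ ⁅ v ⁆) w x w∈
  ... | inj₂ refl = inj₂ (inj₂ (∈pairʳ u w , ∈pairʳ v w))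
  ... | inj₁ w∈uv with lookup-pair⁻ u v w w∈uv
  ...   | inj₁ refl = inj₁ (∈pairˡ w x , refl)
  ...   | inj₂ refl = inj₂ (inj₁ (∈pairˡ w x , refl))
... | inj₁ (p∈ux , _)        | inj₁ (q∈ux , _)        = inj₁ (pair⊆ (⁅ u ⁆ ∪ ⁅ x ⁆) p q p∈ux q∈ux)
... | inj₁ (p∈ux , _)        | inj₂ (inj₂ (q∈ux , _)) = inj₁ (pair⊆ (⁅ u ⁆ ∪ ⁅ x ⁆) p q p∈ux q∈ux)
... | inj₂ (inj₂ (p∈ux , _)) | inj₁ (q∈ux , _)        = inj₁ (pair⊆ (⁅ u ⁆ ∪ ⁅ x ⁆) p q p∈ux q∈ux)
... | inj₂ (inj₂ (p∈ux , _)) | inj₂ (inj₂ (q∈ux , _)) = inj₁ (pair⊆ (⁅ u ⁆ ∪ ⁅ x ⁆) p q p∈ux q∈ux)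
... | inj₂ (inj₁ (p∈vx , _)) | inj₂ (inj₁ (q∈vx , _)) = inj₂ (inj₁ (pair⊆ (⁅ v ⁆ ∪ ⁅ x ⁆) p q p∈vx q∈vx))
... | inj₂ (inj₁ (p∈vx , _)) | inj₂ (inj₂ (_ , q∈vx)) = inj₂ (inj₁ (pair⊆ (⁅ v ⁆ ∪ ⁅ x ⁆) p q p∈vx q∈vx))
... | inj₂ (inj₂ (_ , p∈vx)) | inj₂ (inj₁ (q∈vx , _)) = inj₂ (inj₁ (pair⊆ (⁅ v ⁆ ∪ ⁅ x ⁆) p q p∈vx q∈vx))
... | inj₁ (_ , refl)        | inj₂ (inj₁ (_ , refl)) = inj₂ (inj₂ (⊆-refl (⁅ p ⁆ ∪ ⁅ q ⁆)))
... | inj₂ (inj₁ (_ , refl)) | inj₁ (_ , refl)        = inj₂ (inj₂ (pair-swap⊆ p q))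

colon-plusVariables : (F : SimpleGraph n) (J : SqIdeal n) (x : Fin n) →
                      EdgeIdealPlusVariables F J → EdgeIdealPlusVariables F (colon J x)
colon-plusVariables F J x E = record
  { upClosed        = colon-upClosed J x upClosed
  ; degree≤2        = colon-degree≤2 J x upClosed degree≤2
  ; edges∈          = λ u v u~v → colon-⊇ J x upClosed (⁅ u ⁆ ∪ ⁅ v ⁆) (edges∈ u v u~v)
  ; pairs-are-edges = pairs-are-edges′
  }
  where
  open EdgeIdealPlusVariables E
  outside : ∀ y → colon J x ⁅ y ⁆ ≡ false → ∀ ρ → ρ ⊆ ⁅ y ⁆ ∪ ⁅ x ⁆ → J ρ ≡ false
  outside y y∉ ρ ρ⊆ = ¬-not λ ρ∈J → absurdᵇ (upClosed ρ _ ρ⊆ ρ∈J) (∨-conicalʳ (Vec.lookup ⁅ y ⁆ x) _ y∉)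
  uvx∈J : ∀ u v → colon J x ⁅ u ⁆ ≡ false → colon J x ⁅ v ⁆ ≡ false → colon J x (⁅ u ⁆ ∪ ⁅ v ⁆) ≡ true →
          J ((⁅ u ⁆ ∪ ⁅ v ⁆) ∪ ⁅ x ⁆) ≡ true
  uvx∈J u v u∉ v∉ uv∈ = trans (cong (_∨ J ((⁅ u ⁆ ∪ ⁅ v ⁆) ∪ ⁅ x ⁆)) (sym x∉uv)) uv∈
    where
    x∉uv : Vec.lookup (⁅ u ⁆ ∪ ⁅ v ⁆) x ≡ false
    x∉uv = trans (lookup-∪ ⁅ u ⁆ ⁅ v ⁆ x)
                 (cong₂ _∨_ (∨-conicalˡ _ (J (⁅ u ⁆ ∪ ⁅ x ⁆)) u∉) (∨-conicalˡ _ (J (⁅ v ⁆ ∪ ⁅ x ⁆)) v∉))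
  pairs-are-edges′ : ∀ u v → colon J x ⁅ u ⁆ ≡ false → colon J x ⁅ v ⁆ ≡ false →
                     colon J x (⁅ u ⁆ ∪ ⁅ v ⁆) ≡ true → adj F u v ≡ true
  pairs-are-edges′ u v u∉ v∉ uv∈ with degree≤2 _ (uvx∈J u v u∉ v∉ uv∈)
  ... | inj₁ ∅∈J = absurdᵇ ∅∈J (outside u u∉ ∅ (∅⊆ (⁅ u ⁆ ∪ ⁅ x ⁆)))
  ... | inj₂ (p , q , p∈ , q∈ , pq∈J) with pair-in-triple u v x p q p∈ q∈
  ...   | inj₁ pq⊆ux        = absurdᵇ pq∈J (outside u u∉ _ pq⊆ux)
  ...   | inj₂ (inj₁ pq⊆vx) = absurdᵇ pq∈J (outside v v∉ _ pq⊆vx)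
  ...   | inj₂ (inj₂ pq⊆uv) = pairs-are-edges u v
          (outside u u∉ ⁅ u ⁆ (⁅x⁆⊆ (⁅ u ⁆ ∪ ⁅ x ⁆) u (∈pairˡ u x)))
          (outside v v∉ ⁅ v ⁆ (⁅x⁆⊆ (⁅ v ⁆ ∪ ⁅ x ⁆) v (∈pairˡ v x)))
          (upClosed (⁅ p ⁆ ∪ ⁅ q ⁆) (⁅ u ⁆ ∪ ⁅ v ⁆) pq⊆uv pq∈J)

module Leaves (F : SimpleGraph n) (forest : Forest F) (J : SqIdeal n)
              (E : EdgeIdealPlusVariables F J) (∅∉J : J ∅ ≡ false) where

  open EdgeIdealPlusVariables E

  Remaining : Fin n → Set
  Remaining v = J ⁅ v ⁆ ≡ false

  record Path (k : ℕ) : Set where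
    field
      vertex    : Fin (2 + k) → Fin n
      injective : Injective _≡_ _≡_ vertex
      remaining : ∀ j → Remaining (vertex j)
      adjacent  : ∀ (j : Fin (ℕ.suc k)) → adj F (vertex (inject₁ j)) (vertex (suc j)) ≡ true

  record Leaf : Set where
    field
      leaf parent      : Fin n
      leaf-remaining   : Remaining leaf
      parent-remaining : Remaining parent
      edge             : adj F leaf parent ≡ true
      unique-parent    : ∀ y → Remaining y → adj F leaf y ≡ true → y ≡ parent

  other-neighbour? : (x z : Fin n) → Dec (∃ λ y → Remaining y × adj F x y ≡ true × y ≢ z)
  other-neighbour? x z = any? λ y → (J ⁅ y ⁆ Bool.≟ false) ×-dec (adj F x y Bool.≟ true) ×-dec ¬? (y ≟ z)

  no-chord : ∀ {k} (P : Path k) (j : Fin k) →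
             adj F (Path.vertex P zero) (Path.vertex P (suc (suc j))) ≡ true → ⊥
  no-chord {k} P j chord = forest record
    { m       = m
    ; long    = ℕ.s≤s (ℕ.s≤s ℕ.z≤n)
    ; f       = cycle
    ; f-inj   = λ eq → inject≤-injective _ _ _ _ (injective eq)
    ; steps   = λ i → subst (λ s → adj F (vertex s) (cycle (suc i)) ≡ true) (inject≤-inject₁ i)
                              (adjacent (inject≤ i m≤))
    ; closing = subst (λ s → adj F (vertex s) (vertex zero) ≡ true) (sym last≡) (adj-sym F chord)
    }
    where
    open Path P
    m : ℕ
    m = 2 + toℕ j
    m≤ : m ℕ.≤ ℕ.suc k
    m≤ = ℕ.s≤s (toℕ<n j)
    cycle : Fin (ℕ.suc m) → Fin n
    cycle t = vertex (inject≤ t (ℕ.s≤s m≤))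
    inject≤-inject₁ : ∀ i → inject₁ (inject≤ i m≤) ≡ inject≤ (inject₁ i) (ℕ.s≤s m≤)
    inject≤-inject₁ i = toℕ-injective (trans (toℕ-inject₁ _) (trans (toℕ-inject≤ i m≤)
                          (sym (trans (toℕ-inject≤ (inject₁ i) _) (toℕ-inject₁ i)))))
    last≡ : inject≤ (fromℕ m) (ℕ.s≤s m≤) ≡ suc (suc j)
    last≡ = toℕ-injective (trans (toℕ-inject≤ (fromℕ m) (ℕ.s≤s m≤)) (toℕ-fromℕ m))

  prepend : ∀ {k} (P : Path k) (y : Fin n) → Remaining y → adj F y (Path.vertex P zero) ≡ true →
            (∀ j → Path.vertex P j ≢ y) → Path (ℕ.suc k)
  prepend P y y-remaining y~v₀ fresh = record
    { vertex = vertex′ ; injective = injective′ ; remaining = remaining′ ; adjacent = adjacent′ }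
    where
    open Path P
    vertex′ : Fin _ → Fin n
    vertex′ zero    = y
    vertex′ (suc j) = vertex j
    injective′ : Injective _≡_ _≡_ vertex′
    injective′ {zero}  {zero}  _  = refl
    injective′ {zero}  {suc j} eq = ⊥-elim (fresh j (sym eq))
    injective′ {suc i} {zero}  eq = ⊥-elim (fresh i eq)
    injective′ {suc i} {suc j} eq = cong suc (injective eq)
    remaining′ : ∀ j → Remaining (vertex′ j)
    remaining′ zero    = y-remaining
    remaining′ (suc j) = remaining j
    adjacent′ : ∀ j → adj F (vertex′ (inject₁ j)) (vertex′ (suc j)) ≡ true
    adjacent′ zero    = y~v₀
    adjacent′ (suc j) = adjacent j

  extend-to-leaf : (fuel k : ℕ) → n ℕ.≤ k + fuel → Path k → Leaf
  extend-to-leaf ℕ.zero k n≤k P =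
    ⊥-elim (ℕ.1+n≰n (ℕ.≤-trans (ℕ.n≤1+n (ℕ.suc k))
      (ℕ.≤-trans (injective⇒≤ (Path.injective P)) (ℕ.≤-trans n≤k (ℕ.≤-reflexive (ℕ.+-identityʳ k))))))
  extend-to-leaf (ℕ.suc fuel) k n≤ P with other-neighbour? (vertex zero) (vertex (suc zero))
    where open Path P
  ... | no none = record
    { leaf             = vertex zero
    ; parent           = vertex (suc zero)
    ; leaf-remaining   = remaining zero
    ; parent-remaining = remaining (suc zero)
    ; edge             = adjacent zero
    ; unique-parent    = unique
    }
    where
    open Path P
    unique : ∀ y → Remaining y → adj F (vertex zero) y ≡ true → y ≡ vertex (suc zero)
    unique y y-remaining v₀~y with y ≟ vertex (suc zero)
    ... | yes y≡v₁ = y≡v₁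
    ... | no  y≢v₁ = ⊥-elim (none (y , y-remaining , v₀~y , y≢v₁))
  ... | yes (y , y-remaining , v₀~y , y≢v₁) with any? (λ j → Path.vertex P j ≟ y)
  ...   | yes (zero , v₀≡y)        = ⊥-elim (adj-irrefl F _ y v₀~y v₀≡y)
  ...   | yes (suc zero , v₁≡y)    = ⊥-elim (y≢v₁ (sym v₁≡y))
  ...   | yes (suc (suc j) , vⱼ≡y) =
    ⊥-elim (no-chord P j (subst (λ t → adj F (Path.vertex P zero) t ≡ true) (sym vⱼ≡y) v₀~y))
  ...   | no  fresh = extend-to-leaf fuel (ℕ.suc k) (subst (n ℕ.≤_) (ℕ.+-suc k fuel) n≤)
                        (prepend P y y-remaining (adj-sym F v₀~y) (λ j vⱼ≡y → fresh (j , vⱼ≡y)))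

  leaf-dominated : (L : Leaf) → Dominates J (Leaf.parent L) (Leaf.leaf L)
  leaf-dominated L = leaf-not-apex , leaf-apex-of-J+parent
    where
    open Leaf L renaming (leaf to l; parent to p)
    l≢p : l ≢ p
    l≢p = adj-irrefl F l p edge
    p∉⁅l⁆ : Vec.lookup ⁅ l ⁆ p ≡ false
    p∉⁅l⁆ = lookup-⁅y⁆ p l (l≢p ∘ sym)
    leaf-not-apex : ¬ IsCone J l
    leaf-not-apex cone = absurdᵇ pl∈colon (trans (cone ⁅ p ⁆) (cong₂ _∨_ parent-remaining l∉⁅p⁆))
      where
      l∉⁅p⁆ : Vec.lookup ⁅ p ⁆ l ≡ false
      l∉⁅p⁆ = lookup-⁅y⁆ l p l≢p
      pl∈colon : colon J l ⁅ p ⁆ ≡ true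
      pl∈colon = trans (cong (_∨ J (⁅ p ⁆ ∪ ⁅ l ⁆)) l∉⁅p⁆) (edges∈ p l (adj-sym F edge))
    leaf-apex-of-J+parent : IsCone (addVar J p) l
    leaf-apex-of-J+parent =
      isCone-criterion (addVar J p) (addVar-upClosed J p upClosed) (addVar-degree≤2 J p degree≤2)
                       (cong₂ _∨_ ∅∉J (lookup-∅ p)) l (cong₂ _∨_ leaf-remaining p∉⁅l⁆) isolated
      where
      isolated : ∀ y → y ≢ l → addVar J p ⁅ y ⁆ ≡ false → addVar J p (⁅ y ⁆ ∪ ⁅ l ⁆) ≡ false
      isolated y _ y∉ = cong₂ _∨_ yl∉J (trans (lookup-∪ ⁅ y ⁆ ⁅ l ⁆ p) (cong₂ _∨_ p∉⁅y⁆ p∉⁅l⁆))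
        where
        p∉⁅y⁆ : Vec.lookup ⁅ y ⁆ p ≡ false
        p∉⁅y⁆ = ∨-conicalʳ (J ⁅ y ⁆) _ y∉
        y-remaining : Remaining y
        y-remaining = ∨-conicalˡ _ _ y∉
        yl∉J : J (⁅ y ⁆ ∪ ⁅ l ⁆) ≡ false
        yl∉J = ¬-not λ yl∈J →
          let l~y = adj-sym F (pairs-are-edges y l y-remaining leaf-remaining yl∈J)
              y≡p = unique-parent y y-remaining l~y
          in  absurdᵇ (subst (λ t → Vec.lookup ⁅ y ⁆ t ≡ true) y≡p (lookup-⁅x⁆ y)) p∉⁅y⁆

  resolvable : ∀ x → Remaining x → ∃ λ a → Remaining a × (IsCone J a ⊎ ∃ λ b → Dominates J a b)
  resolvable x x-remaining with other-neighbour? x x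
  ... | no none = x , x-remaining , inj₁ (isCone-criterion J upClosed degree≤2 ∅∉J x x-remaining isolated)
    where
    isolated : ∀ y → y ≢ x → Remaining y → J (⁅ y ⁆ ∪ ⁅ x ⁆) ≡ false
    isolated y y≢x y-remaining = ¬-not λ yx∈J →
      none (y , y-remaining , adj-sym F (pairs-are-edges y x y-remaining x-remaining yx∈J) , y≢x)
  ... | yes (y , y-remaining , x~y , _) = parent , parent-remaining , inj₂ (leaf , leaf-dominated L)
    where
    edge-path : Path 0
    edge-path = record
      { vertex = vertex ; injective = injective ; remaining = remaining ; adjacent = adjacent }
      where
      vertex : Fin 2 → Fin n
      vertex zero       = y
      vertex (suc zero) = x
      injective : Injective _≡_ _≡_ vertex
      injective {zero}     {zero}     _  = refl
      injective {zero}     {suc zero} eq = ⊥-elim (adj-irrefl F x y x~y (sym eq))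
      injective {suc zero} {zero}     eq = ⊥-elim (adj-irrefl F x y x~y eq)
      injective {suc zero} {suc zero} _  = refl
      remaining : ∀ j → Remaining (vertex j)
      remaining zero       = y-remaining
      remaining (suc zero) = x-remaining
      adjacent : ∀ j → adj F (vertex (inject₁ j)) (vertex (suc j)) ≡ true
      adjacent zero = adj-sym F x~y
    L : Leaf
    L = extend-to-leaf n 0 ℕ.≤-refl edge-path
    open Leaf L

ResolutionStep : SqIdeal n → Fin n → Set
ResolutionStep {n} I x = ¬ (x ∈I I) × (IsCone I x ⊎ ∃ λ (b : Fin n) → Dominates I x b)

resolution-snoc : (I : SqIdeal n) (A : List (Fin n)) (a : Fin n) → IsResolution I A →
                  ResolutionStep (colonProd I A) a → IsResolution I (A ∷ʳ a)
resolution-snoc I []      a res new zero    = new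
resolution-snoc I (x ∷ A) a res new zero    = res zero
resolution-snoc I (x ∷ A) a res new (suc i) = resolution-snoc (colon I x) A a (res ∘ suc) new i

colonProd-plusVariables : (F : SimpleGraph n) (J : SqIdeal n) → EdgeIdealPlusVariables F J →
                          ∀ A → EdgeIdealPlusVariables F (colonProd J A)
colonProd-plusVariables F J E []      = E
colonProd-plusVariables F J E (x ∷ A) = colonProd-plusVariables F (colon J x) (colon-plusVariables F J x E) A

maximal-resolution-exhausts : (F : SimpleGraph n) → Forest F → (A : List (Fin n)) →
                              IsMaximalResolution (edgeIdeal F) A →
                              ∀ v → colonProd (edgeIdeal F) A ⁅ v ⁆ ≡ true
maximal-resolution-exhausts F forest A (res , maximal) v with colonProd (edgeIdeal F) A ⁅ v ⁆ in v∉
... | true  = refl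
... | false with Leaves.resolvable F forest (colonProd (edgeIdeal F) A)
                   (colonProd-plusVariables F _ (edgeIdeal-plusVariables F) A)
                   (colonProd-∅ (edgeIdeal F) A (edgeIdeal-upClosed F) (edgeIdeal-∅ F) (proj₁ ∘ res)) v v∉
...   | a , a-remaining , a-resolves =
  ⊥-elim (maximal (a , resolution-snoc (edgeIdeal F) A a res ((λ a∈ → absurdᵇ a∈ a-remaining) , a-resolves)))

-- Distinctness of the variables and the ordering

interleave : ∀ {r} {X : Set} → (Fin r → X) → (Fin r → X) → Fin (r * 2) → X
interleave {ℕ.suc r} a b zero          = a zero
interleave {ℕ.suc r} a b (suc zero)    = b zero
interleave {ℕ.suc r} a b (suc (suc t)) = interleave (a ∘ suc) (b ∘ suc) t

interleave-all : ∀ {r} {X : Set} (P : X → Set) (a b : Fin r → X) → (∀ i → P (a i) × P (b i)) →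
                 ∀ t → P (interleave a b t)
interleave-all {ℕ.suc r} P a b Pab zero          = proj₁ (Pab zero)
interleave-all {ℕ.suc r} P a b Pab (suc zero)    = proj₂ (Pab zero)
interleave-all {ℕ.suc r} P a b Pab (suc (suc t)) = interleave-all P (a ∘ suc) (b ∘ suc) (Pab ∘ suc) t

interleave-injective : ∀ {r} {X : Set} (a b : Fin (ℕ.suc r) → X) → a zero ≢ b zero →
  (∀ t → interleave (a ∘ suc) (b ∘ suc) t ≢ a zero × interleave (a ∘ suc) (b ∘ suc) t ≢ b zero) →
  Injective _≡_ _≡_ (interleave (a ∘ suc) (b ∘ suc)) → Injective _≡_ _≡_ (interleave a b)
interleave-injective a b a≢b fresh inj {zero}        {zero}        eq = refl
interleave-injective a b a≢b fresh inj {zero}        {suc zero}    eq = ⊥-elim (a≢b eq)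
interleave-injective a b a≢b fresh inj {suc zero}    {zero}        eq = ⊥-elim (a≢b (sym eq))
interleave-injective a b a≢b fresh inj {suc zero}    {suc zero}    eq = refl
interleave-injective a b a≢b fresh inj {zero}        {suc (suc t)} eq = ⊥-elim (proj₁ (fresh t) (sym eq))
interleave-injective a b a≢b fresh inj {suc zero}    {suc (suc t)} eq = ⊥-elim (proj₂ (fresh t) (sym eq))
interleave-injective a b a≢b fresh inj {suc (suc s)} {zero}        eq = ⊥-elim (proj₁ (fresh s) eq)
interleave-injective a b a≢b fresh inj {suc (suc s)} {suc zero}    eq = ⊥-elim (proj₂ (fresh s) eq)
interleave-injective a b a≢b fresh inj {suc (suc s)} {suc (suc t)} eq = cong (suc ∘ suc) (inj eq)

resolution-variables-distinct : (J : SqIdeal n) (A : List (Fin n)) (b : Fin (length A) → Fin n) →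
  UpClosed J → GeneratedInDegree≤2 J → (∀ i → ¬ (lookup A i ∈I stage J A i)) →
  (∀ i → Dominates (stage J A i) (lookup A i) (b i)) → Injective _≡_ _≡_ (interleave (lookup A) b)
resolution-variables-distinct J []      b J-up J-gen a∉ dom {()}
resolution-variables-distinct {n} J (a ∷ A) b J-up J-gen a∉ dom =
  interleave-injective (lookup (a ∷ A)) b a≢b
    (λ t → separated a∈J′ (later-outside t) , separated b∈J′ (later-outside t))
    (resolution-variables-distinct J′ A (b ∘ suc) J′-up J′-gen (a∉ ∘ suc) (dom ∘ suc))
  where
  J′ : SqIdeal n
  J′ = colon J a
  J′-up : UpClosed J′
  J′-up = colon-upClosed J a J-up
  J′-gen : GeneratedInDegree≤2 J′
  J′-gen = colon-degree≤2 J a J-up J-gen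
  open DominationFacts
    (domination-facts J J-up J-gen (var∉⇒∅∉ J a J-up (¬-not (a∉ zero))) a (b zero) (dom zero))
  a∈J′ : J′ ⁅ a ⁆ ≡ true
  a∈J′ = cong (_∨ J (⁅ a ⁆ ∪ ⁅ a ⁆)) (lookup-⁅x⁆ a)
  b∈J′ : J′ ⁅ b zero ⁆ ≡ true
  b∈J′ = colon-intro J a J-up ⁅ b zero ⁆ (⁅ a ⁆ ∪ ⁅ b zero ⁆) (pair-swap⊆ a (b zero)) ab∈I
  separated : ∀ {x y} → J′ ⁅ x ⁆ ≡ true → J′ ⁅ y ⁆ ≡ false → y ≢ x
  separated x∈J′ y∉J′ refl = absurdᵇ x∈J′ y∉J′
  stage-outside : ∀ i → J′ ⁅ lookup A i ⁆ ≡ false × J′ ⁅ b (suc i) ⁆ ≡ false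
  stage-outside i = outside (lookup A i) aᵢ∉S , outside (b (suc i)) (DominationFacts.b∉I stage-facts)
    where
    S : SqIdeal n
    S = stage J′ A i
    S-up : UpClosed S
    S-up = colonProd-upClosed J′ J′-up (List.take (toℕ i) A)
    aᵢ∉S : S ⁅ lookup A i ⁆ ≡ false
    aᵢ∉S = ¬-not (a∉ (suc i))
    stage-facts : DominationFacts S (lookup A i) (b (suc i))
    stage-facts = domination-facts S S-up (colonProd-degree≤2 J′ J′-up J′-gen (List.take (toℕ i) A))
                    (var∉⇒∅∉ S (lookup A i) S-up aᵢ∉S) (lookup A i) (b (suc i)) (dom (suc i))
    outside : ∀ x → S ⁅ x ⁆ ≡ false → J′ ⁅ x ⁆ ≡ false
    outside x x∉S = ¬-not λ x∈J′ → absurdᵇ (colonProd-⊇ J′ J′-up (List.take (toℕ i) A) ⁅ x ⁆ x∈J′) x∉S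
  later-outside : ∀ t → J′ ⁅ interleave (lookup A) (b ∘ suc) t ⁆ ≡ false
  later-outside = interleave-all (λ x → J′ ⁅ x ⁆ ≡ false) (lookup A) (b ∘ suc) stage-outside

transpose-fixes : (i j k : Fin n) → k ≢ i → k ≢ j → PC.transpose i j k ≡ k
transpose-fixes i j k k≢i k≢j rewrite dec-false (k ≟ i) k≢i | dec-false (k ≟ j) k≢j = refl

transpose-sends : (i j : Fin n) → PC.transpose i j i ≡ j
transpose-sends i j rewrite dec-true (i ≟ i) refl = refl

-- By induction on m: the transposition moving g (fromℕ m) to position m fixes the positions < m.
injection⇒permutation : ∀ {m} (g : Fin m → Fin n) → Injective _≡_ _≡_ g →
                        ∃ λ (π : Permutation′ n) → ∀ t → toℕ (π ⟨$⟩ʳ g t) ≡ toℕ t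
injection⇒permutation {m = ℕ.zero}  g _     = Perm.id , λ ()
injection⇒permutation {n} {ℕ.suc m} g g-inj = π′ Perm.∘ₚ Perm.transpose q p , position
  where
  IH : ∃ λ (π : Permutation′ n) → ∀ s → toℕ (π ⟨$⟩ʳ g (inject₁ s)) ≡ toℕ s
  IH = injection⇒permutation (g ∘ inject₁) (λ eq → inject₁-injective (g-inj eq))
  π′ : Permutation′ n
  π′ = proj₁ IH
  m<n : m ℕ.< n
  m<n = injective⇒≤ g-inj
  p q : Fin n
  p = fromℕ< m<n
  q = π′ ⟨$⟩ʳ g (fromℕ m)
  position-inject₁ : ∀ s → toℕ (PC.transpose q p (π′ ⟨$⟩ʳ g (inject₁ s))) ≡ toℕ (inject₁ s)
  position-inject₁ s = begin
    toℕ (PC.transpose q p (π′ ⟨$⟩ʳ g (inject₁ s))) ≡⟨ cong toℕ (transpose-fixes q p _ ≢q ≢p) ⟩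
    toℕ (π′ ⟨$⟩ʳ g (inject₁ s))                    ≡⟨ proj₂ IH s ⟩
    toℕ s                                          ≡⟨ toℕ-inject₁ s ⟨
    toℕ (inject₁ s)                                ∎
    where
    open ≡-Reasoning
    ≢q : π′ ⟨$⟩ʳ g (inject₁ s) ≢ q
    ≢q eq = fromℕ≢inject₁ (sym (g-inj (permutation-injective π′ eq)))
    ≢p : π′ ⟨$⟩ʳ g (inject₁ s) ≢ p
    ≢p eq = ℕ.<-irrefl (trans (sym (proj₂ IH s)) (trans (cong toℕ eq) (toℕ-fromℕ< m<n))) (toℕ<n s)
  position : ∀ t → toℕ (PC.transpose q p (π′ ⟨$⟩ʳ g t)) ≡ toℕ t
  position t with t ≟ fromℕ m
  ... | yes refl = trans (cong toℕ (transpose-sends q p)) (trans (toℕ-fromℕ< m<n) (sym (toℕ-fromℕ m)))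
  ... | no  t≢m  = subst (λ t → toℕ (PC.transpose q p (π′ ⟨$⟩ʳ g t)) ≡ toℕ t) (inject₁-lower₁ t m≢t)
                         (position-inject₁ (lower₁ t m≢t))
    where
    m≢t : m ≢ toℕ t
    m≢t m≡t = t≢m (toℕ-injective (trans (sym m≡t) (sym (toℕ-fromℕ m))))

evenIx oddIx : ∀ {r} → Fin r → Fin (r * 2)
evenIx zero    = zero
evenIx (suc i) = suc (suc (evenIx i))
oddIx zero    = suc zero
oddIx (suc i) = suc (suc (oddIx i))

module _ {X : Set} where

  interleave-evenIx : ∀ {r} (a b : Fin r → X) i → interleave a b (evenIx i) ≡ a i
  interleave-evenIx a b zero    = refl
  interleave-evenIx a b (suc i) = interleave-evenIx (a ∘ suc) (b ∘ suc) i

  interleave-oddIx : ∀ {r} (a b : Fin r → X) i → interleave a b (oddIx i) ≡ b i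
  interleave-oddIx a b zero    = refl
  interleave-oddIx a b (suc i) = interleave-oddIx (a ∘ suc) (b ∘ suc) i

toℕ-evenIx : ∀ {r} (i : Fin r) → toℕ (evenIx i) ≡ 2 * toℕ i
toℕ-evenIx zero    = refl
toℕ-evenIx (suc i) = trans (cong (ℕ.suc ∘ ℕ.suc) (toℕ-evenIx i)) (sym (ℕ.*-suc 2 (toℕ i)))

toℕ-oddIx : ∀ {r} (i : Fin r) → toℕ (oddIx i) ≡ 2 * toℕ i + 1
toℕ-oddIx zero    = refl
toℕ-oddIx (suc i) = trans (cong (ℕ.suc ∘ ℕ.suc) (toℕ-oddIx i)) (cong (_+ 1) (sym (ℕ.*-suc 2 (toℕ i))))

interleaving-order-exists : ∀ {r} (a b : Fin r → Fin n) → Injective _≡_ _≡_ (interleave a b) →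
                            ∃ λ (π : Permutation′ n) → RanksInterleaved π 0 r a b
interleaving-order-exists {n} a b inj = π , λ i →
  trans (cong (rank π) (sym (interleave-evenIx a b i))) (trans (position (evenIx i)) (toℕ-evenIx i)) ,
  trans (cong (rank π) (sym (interleave-oddIx a b i))) (trans (position (oddIx i)) (toℕ-oddIx i))
  where
  π : Permutation′ n
  π = proj₁ (injection⇒permutation (interleave a b) inj)
  position : ∀ t → toℕ (π ⟨$⟩ʳ interleave a b t) ≡ toℕ t
  position = proj₂ (injection⇒permutation (interleave a b) inj)

-- Expanding the product of the binomials

choose : ∀ {r} → (Fin r → Fin n) → (Fin r → Fin n) → Vec Bool r → List (Fin n)
choose a b s = List.tabulate (λ i → if Vec.lookup s i then b i else a i)

expansionTerm : ∀ {r} → (Fin r → Fin n) → (Fin r → Fin n) → Subset n → Vec Bool r → ℤ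
expansionTerm {r = r} a b σ s =
  if eqSub σ (listSet (choose a b s)) ∧ (∣ listSet (choose a b s) ∣ ℕ.≡ᵇ r) then negPow (countTrue s) else 0ℤ

expansion : (r : ℕ) → (Fin r → Fin n) → (Fin r → Fin n) → Chain n
expansion r a b σ = ∑ (allChoices r) (expansionTerm a b σ)

productCycle-expansion : ∀ {r} (I : SqIdeal n) (a b : Fin r → Fin n) (σ : Subset n) →
                         productCycle I a b σ ≡ (if I σ then 0ℤ else expansion r a b σ)
productCycle-expansion {r = r} I a b σ with I σ
... | true  = ∑-zero (allChoices r) λ s → cong (if_then negPow (countTrue s) else 0ℤ)
                (trans (cong (eqSub σ (listSet (choose a b s)) ∧_) (∧-zeroʳ _)) (∧-zeroʳ _))
... | false = ∑-cong (allChoices r) λ s → cong (if_then negPow (countTrue s) else 0ℤ)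
                (cong (eqSub σ (listSet (choose a b s)) ∧_) (∧-identityʳ _))

listSet-tabulate-∌ : ∀ {m} (g : Fin m → Fin n) (x : Fin n) → (∀ i → g i ≢ x) →
                     Vec.lookup (listSet (List.tabulate g)) x ≡ false
listSet-tabulate-∌ {m = ℕ.zero}  g x g≢x = lookup-∅ x
listSet-tabulate-∌ {m = ℕ.suc m} g x g≢x = trans (lookup-∪ ⁅ g zero ⁆ _ x)
  (cong₂ _∨_ (lookup-⁅y⁆ x (g zero) (g≢x zero ∘ sym)) (listSet-tabulate-∌ (g ∘ suc) x (g≢x ∘ suc)))

∣⁅x⁆∪p∣ : (x : Fin n) (p : Subset n) → Vec.lookup p x ≡ false → ∣ ⁅ x ⁆ ∪ p ∣ ≡ ℕ.suc ∣ p ∣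
∣⁅x⁆∪p∣ zero    (false ∷ p) refl = cong (ℕ.suc ∘ ∣_∣) (∪-identityˡ p)
∣⁅x⁆∪p∣ (suc x) (true ∷ p)  x∉p  = cong ℕ.suc (∣⁅x⁆∪p∣ x p x∉p)
∣⁅x⁆∪p∣ (suc x) (false ∷ p) x∉p  = ∣⁅x⁆∪p∣ x p x∉p

eqSub-insert : (σ : Subset n) (x : Fin n) (p : Subset n) → Vec.lookup p x ≡ false →
               eqSub σ (⁅ x ⁆ ∪ p) ≡ (Vec.lookup σ x ∧ eqSub (σ - x) p)
eqSub-insert (true ∷ σ)  zero    (false ∷ p) refl = cong₂ eqSub (sym (p─⊥≡p σ)) (∪-identityˡ p)
eqSub-insert (false ∷ σ) zero    (false ∷ p) refl = refl
eqSub-insert (s ∷ σ)     (suc x) (t ∷ p)     x∉p  rewrite eqSub-insert σ x p x∉p =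
  ∧-left-comm (if s then t else not t) (Vec.lookup σ x) (eqSub (σ - x) p)

module _ {A : Set} where

  ∑-concatMap-pair : {B : Set} (xs : List A) (f g : A → B) (h : B → ℤ) →
                     ∑ (List.concatMap (λ x → f x ∷ g x ∷ []) xs) h ≡ ∑ xs (λ x → h (f x) ℤ.+ h (g x))
  ∑-concatMap-pair []       f g h = refl
  ∑-concatMap-pair (x ∷ xs) f g h rewrite ∑-concatMap-pair xs f g h =
    sym (ℤ.+-assoc (h (f x)) (h (g x)) _)

  ∑-if : (xs : List A) (c : Bool) (g : A → ℤ) →
         ∑ xs (λ x → if c then g x else 0ℤ) ≡ (if c then ∑ xs g else 0ℤ)
  ∑-if xs true  g = refl
  ∑-if xs false g = ∑-zero xs (λ _ → refl)

interleave-tail-avoids-head : ∀ {r} (a b : Fin (ℕ.suc r) → Fin n) → Injective _≡_ _≡_ (interleave a b) →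
                              ∀ x → x ≡ a zero ⊎ x ≡ b zero → ∀ i → a (suc i) ≢ x × b (suc i) ≢ x
interleave-tail-avoids-head a b inj x x∈ i =
  avoids (evenIx i) (interleave-evenIx a b (suc i)) , avoids (oddIx i) (interleave-oddIx a b (suc i))
  where
  avoids : ∀ t {y} → interleave a b (suc (suc t)) ≡ y → y ≢ x
  avoids t eq y≡x = [ (λ x≡a → case inj {x = suc (suc t)} {y = zero} (trans eq (trans y≡x x≡a)) of λ ())
                    , (λ x≡b → case inj {x = suc (suc t)} {y = suc zero} (trans eq (trans y≡x x≡b)) of λ ())
                    ]′ x∈

interleave-tail-injective : ∀ {r} (a b : Fin (ℕ.suc r) → Fin n) → Injective _≡_ _≡_ (interleave a b) →
                            Injective _≡_ _≡_ (interleave (a ∘ suc) (b ∘ suc))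
interleave-tail-injective a b inj eq = suc-injective (suc-injective (inj eq))

expansion-suc : ∀ r (a b : Fin (ℕ.suc r) → Fin n) → Injective _≡_ _≡_ (interleave a b) → ∀ σ →
                expansion (ℕ.suc r) a b σ ≡ mulVarDiff (a zero) (b zero) (expansion r (a ∘ suc) (b ∘ suc)) σ
expansion-suc {n} r a b inj σ = begin
  expansion (ℕ.suc r) a b σ
    ≡⟨ ∑-concatMap-pair Rs (false ∷_) (true ∷_) term ⟩
  ∑ Rs (λ s → term (false ∷ s) ℤ.+ term (true ∷ s))
    ≡⟨ ∑-+ Rs (term ∘ (false ∷_)) (term ∘ (true ∷_)) ⟩
  ∑ Rs (term ∘ (false ∷_)) ℤ.+ ∑ Rs (term ∘ (true ∷_))
    ≡⟨ cong₂ ℤ._+_ (∑-cong Rs choose-a) (∑-cong Rs choose-b) ⟩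
  ∑ Rs (λ s → if a∈?σ then tail (σ - a zero) s else 0ℤ) ℤ.+
  ∑ Rs (λ s → - (if b∈?σ then tail (σ - b zero) s else 0ℤ))
    ≡⟨ cong₂ ℤ._+_ (∑-if Rs a∈?σ (tail (σ - a zero)))
                   (trans (∑-neg Rs (λ s → if b∈?σ then tail (σ - b zero) s else 0ℤ))
                          (cong -_ (∑-if Rs b∈?σ (tail (σ - b zero))))) ⟩
  mulVarDiff (a zero) (b zero) (expansion r (a ∘ suc) (b ∘ suc)) σ
    ∎
  where
  open ≡-Reasoning
  Rs : List (Vec Bool r)
  Rs = allChoices r
  term : Vec Bool (ℕ.suc r) → ℤ
  term = expansionTerm a b σ
  tail : Subset n → Vec Bool r → ℤ
  tail = expansionTerm (a ∘ suc) (b ∘ suc)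
  a∈?σ b∈?σ : Bool
  a∈?σ = Vec.lookup σ (a zero)
  b∈?σ = Vec.lookup σ (b zero)
  chosen : Vec Bool r → Subset n
  chosen s = listSet (choose (a ∘ suc) (b ∘ suc) s)
  ∉chosen : ∀ x → x ≡ a zero ⊎ x ≡ b zero → ∀ s → Vec.lookup (chosen s) x ≡ false
  ∉chosen x x∈ s = listSet-tabulate-∌ _ x avoids
    where
    avoids : ∀ i → (if Vec.lookup s i then b (suc i) else a (suc i)) ≢ x
    avoids i with Vec.lookup s i
    ... | true  = proj₂ (interleave-tail-avoids-head a b inj x x∈ i)
    ... | false = proj₁ (interleave-tail-avoids-head a b inj x x∈ i)
  choose-a : ∀ s → term (false ∷ s) ≡ (if a∈?σ then tail (σ - a zero) s else 0ℤ)
  choose-a s rewrite eqSub-insert σ (a zero) (chosen s) (∉chosen (a zero) (inj₁ refl) s)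
                   | ∣⁅x⁆∪p∣ (a zero) (chosen s) (∉chosen (a zero) (inj₁ refl) s) with a∈?σ
  ... | true  = refl
  ... | false = refl
  choose-b : ∀ s → term (true ∷ s) ≡ - (if b∈?σ then tail (σ - b zero) s else 0ℤ)
  choose-b s rewrite eqSub-insert σ (b zero) (chosen s) (∉chosen (b zero) (inj₂ refl) s)
                   | ∣⁅x⁆∪p∣ (b zero) (chosen s) (∉chosen (b zero) (inj₂ refl) s) with b∈?σ
  ... | false = refl
  ... | true with eqSub (σ - b zero) (chosen s) ∧ (∣ chosen s ∣ ℕ.≡ᵇ r)
  ...   | true  = refl
  ...   | false = refl

expansion≗productChain : ∀ r (a b : Fin r → Fin n) → Injective _≡_ _≡_ (interleave a b) →
                         expansion r a b ≗ productChain r a b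
expansion≗productChain {n} ℕ.zero a b inj σ rewrite ∣⊥∣≡0 n =
  trans (ℤ.+-identityʳ _) (cong (if_then 1ℤ else 0ℤ) (∧-identityʳ (eqSub σ ∅)))
expansion≗productChain (ℕ.suc r) a b inj σ =
  trans (expansion-suc r a b inj σ) (mulVarDiff-cong (a zero) (b zero) tail≗ σ)
  where
  tail≗ : expansion r (a ∘ suc) (b ∘ suc) ≗ productChain r (a ∘ suc) (b ∘ suc)
  tail≗ = expansion≗productChain r (a ∘ suc) (b ∘ suc) (interleave-tail-injective a b inj)

productCycle≗productChain : ∀ r (I : SqIdeal n) (a b : Fin r → Fin n) → Injective _≡_ _≡_ (interleave a b) →
                            Supported I (productChain r a b) → productCycle I a b ≗ productChain r a b
productCycle≗productChain r I a b inj supported σ rewrite productCycle-expansion I a b σ with I σ in σ∈I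
... | true  = sym (supported σ σ∈I)
... | false = expansion≗productChain r a b inj σ

corollary6p7 : ∀ {n : ℕ} (F : SimpleGraph n) → Forest F →
    IsSpherical (edgeIdeal F) →
    (A : List (Fin n)) → IsMaximalResolution (edgeIdeal F) A →
    (b : Fin (length A) → Fin n) →
    (∀ (i : Fin (length A)) → Dominates (stage (edgeIdeal F) A i) (lookup A i) (b i)) →
    (∃ λ (π : Permutation′ n) → ∀ (i : Fin (length A)) →
       (rank π (lookup A i) ≡ 2 * toℕ i) × (rank π (b i) ≡ 2 * toℕ i + 1))
    × (∀ (π : Permutation′ n) → (∀ (i : Fin (length A)) →
         (rank π (lookup A i) ≡ 2 * toℕ i) × (rank π (b i) ≡ 2 * toℕ i + 1)) →
       HomologyGeneratedBy (edgeIdeal F) π (productCycle (edgeIdeal F) (lookup A) b))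
corollary6p7 F forest _ A (res , maximal) b dom = interleaving-order-exists (lookup A) b distinct , homology
  where
  a∉ : ∀ i → ¬ (lookup A i ∈I stage (edgeIdeal F) A i)
  a∉ = proj₁ ∘ res
  distinct : Injective _≡_ _≡_ (interleave (lookup A) b)
  distinct =
    resolution-variables-distinct (edgeIdeal F) A b (edgeIdeal-upClosed F) (edgeIdeal-degree≤2 F) a∉ dom
  homology : ∀ π → RanksInterleaved π 0 (length A) (lookup A) b →
             HomologyGeneratedBy (edgeIdeal F) π (productCycle (edgeIdeal F) (lookup A) b)
  homology π ranks = HomologyGeneratedBy-cong (edgeIdeal F) π (sym ∘ expanded) chain-generates
    where
    chain-generates : HomologyGeneratedBy (edgeIdeal F) π (productChain (length A) (lookup A) b)
    chain-generates =
      resolution-homology π (edgeIdeal F) A b 0 (edgeIdeal-upClosed F) (edgeIdeal-degree≤2 F) (edgeIdeal-∅ F)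
        (λ _ ()) (maximal-resolution-exhausts F forest A (res , maximal)) a∉ dom ranks
    expanded : productCycle (edgeIdeal F) (lookup A) b ≗ productChain (length A) (lookup A) b
    expanded =
      productCycle≗productChain (length A) (edgeIdeal F) (lookup A) b distinct (proj₁ chain-generates)
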